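{- Let $n\ge 1$ and let $K_n$ be the complete graph on $n$ vertices. For every prime power $q$, the number of invertible Schr\"odinger operators of $K_n$ over $\mathbb F_q$ (i.e. the number of invertible $n\times n$ matrices over $\mathbb F_q$ with all off-diagonal entries equal to $1$ and arbitrary diagonal entries) is $$\frac{(q-1)^{n+1}+(-1)^n}{q}+n(q-1)^{n-1}.$$
   Context: A Schr\"odinger operator of a graph $G$ over a field $\mathbb F$ is a matrix $A+D$ where $A$ is the adjacency matrix of $G$ and $D$ is an arbitrary diagonal matrix over $\mathbb F$. -}

module Defs where

open import Level using (0ℓ)
open import Algebra.Bundles using (CommutativeRing)
open import Data.Nat using (ℕ; zero; suc)
open import Data.Fin using (Fin; zero; suc; _≟_)
open import Data.Vec using (Vec; lookup)
open import Data.Product using (Σ; ∃; _×_)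
open import Relation.Nullary using (¬_; yes; no)
open import Relation.Binary.PropositionalEquality using (_≡_)
open import Function.Definitions using (Injective)

module _ (R : CommutativeRing 0ℓ 0ℓ) where
  open CommutativeRing R using (Carrier; _≈_; _+_; _*_; 0#; 1#)

  IsField : Set
  IsField = (¬ (0# ≈ 1#)) × (∀ x → ¬ (x ≈ 0#) → ∃ λ y → (x * y) ≈ 1#)

  Matrix : ℕ → Set
  Matrix n = Fin n → Fin n → Carrier

  sumFin : ∀ {n} → (Fin n → Carrier) → Carrier
  sumFin {zero}  f = 0#
  sumFin {suc n} f = f zero + sumFin (λ k → f (suc k))

  _⊗_ : ∀ {n} → Matrix n → Matrix n → Matrix n
  (M ⊗ N) i j = sumFin (λ k → M i k * N k j)

  identity : ∀ {n} → Matrix n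
  identity i j with i ≟ j
  ... | yes _ = 1#
  ... | no  _ = 0#

  _≋_ : ∀ {n} → Matrix n → Matrix n → Set
  M ≋ N = ∀ i j → M i j ≈ N i j

  Invertible : ∀ {n} → Matrix n → Set
  Invertible M = ∃ λ B → ((M ⊗ B) ≋ identity) × ((B ⊗ M) ≋ identity)

  adjK : ∀ {n} → Matrix n
  adjK i j with i ≟ j
  ... | yes _ = 0#
  ... | no  _ = 1#

  diag : ∀ {n} → Vec Carrier n → Matrix n
  diag d i j with i ≟ j
  ... | yes _ = lookup d i
  ... | no  _ = 0#

  schrodingerK : ∀ {n} → Vec Carrier n → Matrix n
  schrodingerK d i j = adjK i j + diag d i j

HasCount : {A : Set} → (A → Set) → ℕ → Set
HasCount {A} P N =
  Σ (Fin N → A) λ f →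
    Injective _≡_ _≡_ f × (∀ i → P (f i)) × (∀ a → P a → ∃ λ i → f i ≡ a)

module Submission where

-- Write the diagonal as dᵢ = 1 + eᵢ, so the operator is J + diag(e) with J the
-- all-ones matrix.  Let σ = ∑ eᵢ⁻¹ over the i with eᵢ ≠ 0.  Then J + diag(e) is
-- invertible exactly when one eᵢ is 0, or none is and 1 + σ ≠ 0: two zero eᵢ give
-- two equal rows, no zero eᵢ and 1 + σ = 0 put (eᵢ⁻¹)ᵢ in the left kernel, and in
-- the remaining cases an explicit symmetric rank-two correction of diag(e⁻¹) is
-- the inverse.  Counting diagonals coordinate by coordinate then gives
-- n (q−1)ⁿ⁻¹ diagonals with one eᵢ = 0 and, with T(n, c) the number of diagonals
-- with no eᵢ = 0 and σ = c, (q−1)ⁿ − T(n,−1) diagonals of the second kind.  As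
-- x ↦ (x − 1)⁻¹ hits every c ≠ 0 exactly once, T(n, c) only depends on whether
-- c = 0 and obeys a two-term linear recurrence, whose solution yields
-- q · ((q−1)ⁿ − T(n,−1)) = (q−1)ⁿ⁺¹ + (−1)ⁿ.

open import Defs
open import Level using (0ℓ)
open import Algebra.Bundles using (CommutativeRing)
open import Relation.Binary.PropositionalEquality as ≡ using (_≡_)
open import Relation.Binary.Definitions using (DecidableEquality)
open import Data.Nat as ℕ using (ℕ)
open import Data.Fin as Fin using (Fin)
open import Function.Bundles using (_↔_)

module IntegerDifferences where
  open import Data.Nat using (suc)
  open import Data.Integer as ℤ using (ℤ; +_; -[1+_])
  import Data.Integer.Properties as ℤ
  open import Data.Integer.Tactic.RingSolver using (solve-∀)

  positivePart negativePart : ℤ → ℕ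
  positivePart (+ n)    = n
  positivePart -[1+ n ] = 0
  negativePart (+ n)    = 0
  negativePart -[1+ n ] = suc n

  as-difference : ∀ i → i ≡ + positivePart i ℤ.- + negativePart i
  as-difference (+ n)    = ≡.sym (ℤ.+-identityʳ (+ n))
  as-difference -[1+ n ] = ≡.refl

  differences-equal : ∀ a b c d → + a ℤ.- + b ≡ + c ℤ.- + d → a ℕ.+ d ≡ c ℕ.+ b
  differences-equal a b c d eq = ℤ.+-injective (begin
    + a ℤ.+ + d                      ≡⟨ regroup (+ a) (+ b) (+ d) ⟩
    (+ a ℤ.- + b) ℤ.+ (+ b ℤ.+ + d)  ≡⟨ ≡.cong (ℤ._+ (+ b ℤ.+ + d)) eq ⟩
    (+ c ℤ.- + d) ℤ.+ (+ b ℤ.+ + d)  ≡⟨ cancel (+ c) (+ d) (+ b) ⟩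
    + c ℤ.+ + b                      ∎)
    where
    open ≡.≡-Reasoning
    regroup : ∀ x y z → x ℤ.+ z ≡ (x ℤ.- y) ℤ.+ (y ℤ.+ z)
    regroup = solve-∀
    cancel : ∀ x y z → (x ℤ.- y) ℤ.+ (z ℤ.+ y) ≡ x ℤ.+ z
    cancel = solve-∀

  sum-of-differences : ∀ a b c d →
    (+ a ℤ.- + b) ℤ.+ (+ c ℤ.- + d) ≡ + (a ℕ.+ c) ℤ.- + (b ℕ.+ d)
  sum-of-differences a b c d =
    ≡.trans (shuffle (+ a) (+ b) (+ c) (+ d)) (≡.sym (≡.cong₂ ℤ._-_ (ℤ.pos-+ a c) (ℤ.pos-+ b d)))
    where
    shuffle : ∀ x y z w → (x ℤ.- y) ℤ.+ (z ℤ.- w) ≡ (x ℤ.+ z) ℤ.- (y ℤ.+ w)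
    shuffle = solve-∀

  product-of-differences : ∀ a b c d →
    (+ a ℤ.- + b) ℤ.* (+ c ℤ.- + d) ≡ + (a ℕ.* c ℕ.+ b ℕ.* d) ℤ.- + (a ℕ.* d ℕ.+ b ℕ.* c)
  product-of-differences a b c d =
    ≡.trans (expand (+ a) (+ b) (+ c) (+ d)) (≡.sym (≡.cong₂ ℤ._-_ (natural a c b d) (natural a d b c)))
    where
    expand : ∀ x y z w → (x ℤ.- y) ℤ.* (z ℤ.- w) ≡ (x ℤ.* z ℤ.+ y ℤ.* w) ℤ.- (x ℤ.* w ℤ.+ y ℤ.* z)
    expand = solve-∀
    natural : ∀ m n k l → + (m ℕ.* n ℕ.+ k ℕ.* l) ≡ + m ℤ.* + n ℤ.+ + k ℤ.* + l
    natural m n k l = ≡.trans (ℤ.pos-+ (m ℕ.* n) (k ℕ.* l)) (≡.cong₂ ℤ._+_ (ℤ.pos-* m n) (ℤ.pos-* k l))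

  negation-of-difference : ∀ a b → ℤ.- (+ a ℤ.- + b) ≡ + b ℤ.- + a
  negation-of-difference a b = flip (+ a) (+ b)
    where
    flip : ∀ x y → ℤ.- (x ℤ.- y) ≡ y ℤ.- x
    flip = solve-∀

-- The standard library's solver needs a homomorphism from a coefficient
-- ring into R; we use the canonical map ℤ → R, built from the description
-- of integers as differences a − b of naturals.
module IntegerSolver (R : CommutativeRing 0ℓ 0ℓ) where
  import Algebra.Solver.Ring
  open import Algebra.Solver.Ring.AlmostCommutativeRing using (fromCommutativeRing; _-Raw-AlmostCommutative⟶_)
  open import Data.Maybe using (Maybe; just; nothing)
  open import Data.Nat using (suc)
  open import Data.Integer as ℤ using (ℤ; +_; -[1+_])
  import Data.Integer.Properties as ℤ
  open import Relation.Nullary using (yes; no)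
  open IntegerDifferences
  open CommutativeRing R
  open import Algebra.Properties.Ring ring using (-‿+-comm; -‿involutive; -‿distribʳ-*; -0#≈0#; [y-z]x≈yx-zx; x[y-z]≈xy-xz)
  open import Algebra.Properties.Semiring.Mult.TCOptimised semiring using (_×_; ×-homo-+; ×1-homo-*)
  open import Algebra.Properties.CommutativeSemigroup +-commutativeSemigroup using (interchange)
  open import Relation.Binary.Reasoning.Setoid setoid

  swap-difference : ∀ x y → y - x ≈ - (x - y)
  swap-difference x y = begin
    y - x        ≈⟨ +-comm y (- x) ⟩
    - x + y      ≈⟨ +-congˡ (-‿involutive y) ⟨
    - x - - y    ≈⟨ -‿+-comm x (- y) ⟩
    - (x - y)    ∎

  _⊖_ : ℕ → ℕ → Carrier
  a ⊖ b = a × 1# - b × 1#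

  ⊖-cong : ∀ a b c d → a ℕ.+ d ≡ c ℕ.+ b → a ⊖ b ≈ c ⊖ d
  ⊖-cong a b c d eq = begin
    A - B                      ≈⟨ +-identityʳ (A - B) ⟨
    (A - B) + 0#               ≈⟨ +-congˡ (-‿inverseʳ D) ⟨
    (A - B) + (D - D)          ≈⟨ interchange A (- B) D (- D) ⟩
    (A + D) + (- B - D)        ≈⟨ +-cong cross (+-comm (- B) (- D)) ⟩
    (C + B) + (- D - B)        ≈⟨ interchange C B (- D) (- B) ⟩
    (C - D) + (B - B)          ≈⟨ +-congˡ (-‿inverseʳ B) ⟩
    (C - D) + 0#               ≈⟨ +-identityʳ (C - D) ⟩
    C - D                      ∎
    where
    A = a × 1#; B = b × 1#; C = c × 1#; D = d × 1#
    cross : A + D ≈ C + B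
    cross = trans (sym (×-homo-+ 1# a d)) (trans (reflexive (≡.cong (_× 1#) eq)) (×-homo-+ 1# c b))

  ⊖-+ : ∀ a b c d → (a ℕ.+ c) ⊖ (b ℕ.+ d) ≈ (a ⊖ b) + (c ⊖ d)
  ⊖-+ a b c d = begin
    (a ℕ.+ c) × 1# - (b ℕ.+ d) × 1#  ≈⟨ +-cong (×-homo-+ 1# a c) (-‿cong (×-homo-+ 1# b d)) ⟩
    (A + C) - (B + D)                 ≈⟨ +-congˡ (-‿+-comm B D) ⟨
    (A + C) + (- B - D)               ≈⟨ interchange A C (- B) (- D) ⟩
    (A - B) + (C - D)                 ∎
    where A = a × 1#; B = b × 1#; C = c × 1#; D = d × 1#

  ⊖-* : ∀ a b c d → (a ℕ.* c ℕ.+ b ℕ.* d) ⊖ (a ℕ.* d ℕ.+ b ℕ.* c) ≈ (a ⊖ b) * (c ⊖ d)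
  ⊖-* a b c d = begin
    (a ℕ.* c ℕ.+ b ℕ.* d) ⊖ (a ℕ.* d ℕ.+ b ℕ.* c)  ≈⟨ ⊖-+ (a ℕ.* c) (a ℕ.* d) (b ℕ.* d) (b ℕ.* c) ⟩
    ((a ℕ.* c) ⊖ (a ℕ.* d)) + ((b ℕ.* d) ⊖ (b ℕ.* c))
      ≈⟨ +-cong (+-cong (×1-homo-* a c) (-‿cong (×1-homo-* a d))) (+-cong (×1-homo-* b d) (-‿cong (×1-homo-* b c))) ⟩
    (A * C - A * D) + (B * D - B * C)             ≈⟨ +-cong (x[y-z]≈xy-xz A C D) (x[y-z]≈xy-xz B D C) ⟨
    A * (C - D) + B * (D - C)                      ≈⟨ +-congˡ (*-congˡ (swap-difference C D)) ⟩
    A * (C - D) + B * - (C - D)                    ≈⟨ +-congˡ (-‿distribʳ-* B (C - D)) ⟨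
    A * (C - D) - B * (C - D)                      ≈⟨ [y-z]x≈yx-zx (C - D) A B ⟨
    (A - B) * (C - D)                              ∎
    where
    A = a × 1#; B = b × 1#; C = c × 1#; D = d × 1#

  -- The canonical map ℤ → R; the constants 0 and 1 go to 0# and 1# on the nose.
  ⟦_⟧ : ℤ → Carrier
  ⟦ + n ⟧      = n × 1#
  ⟦ -[1+ n ] ⟧ = - (suc n × 1#)

  -- ⟦ i ⟧ is the image of any representation of i as a difference, hence it is
  -- a ring homomorphism.
  ⟦⟧-as-difference : ∀ i → ⟦ i ⟧ ≈ positivePart i ⊖ negativePart i
  ⟦⟧-as-difference (+ n)    = sym (trans (+-congˡ -0#≈0#) (+-identityʳ _))
  ⟦⟧-as-difference -[1+ n ] = sym (+-identityˡ _)

  ⟦⟧-difference : ∀ {i} a b → i ≡ + a ℤ.- + b → ⟦ i ⟧ ≈ a ⊖ b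
  ⟦⟧-difference {i} a b eq = trans (⟦⟧-as-difference i)
    (⊖-cong p n a b (differences-equal p n a b (≡.trans (≡.sym (as-difference i)) eq)))
    where p = positivePart i; n = negativePart i

  ⟦⟧-+ : ∀ i j → ⟦ i ℤ.+ j ⟧ ≈ ⟦ i ⟧ + ⟦ j ⟧
  ⟦⟧-+ i j = begin
    ⟦ i ℤ.+ j ⟧                  ≈⟨ ⟦⟧-difference (a ℕ.+ c) (b ℕ.+ d) eq ⟩
    (a ℕ.+ c) ⊖ (b ℕ.+ d)        ≈⟨ ⊖-+ a b c d ⟩
    (a ⊖ b) + (c ⊖ d)            ≈⟨ +-cong (⟦⟧-as-difference i) (⟦⟧-as-difference j) ⟨
    ⟦ i ⟧ + ⟦ j ⟧                ∎
    where
    a = positivePart i; b = negativePart i; c = positivePart j; d = negativePart j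
    eq = ≡.trans (≡.cong₂ ℤ._+_ (as-difference i) (as-difference j)) (sum-of-differences a b c d)

  ⟦⟧-* : ∀ i j → ⟦ i ℤ.* j ⟧ ≈ ⟦ i ⟧ * ⟦ j ⟧
  ⟦⟧-* i j = begin
    ⟦ i ℤ.* j ⟧
      ≈⟨ ⟦⟧-difference (a ℕ.* c ℕ.+ b ℕ.* d) (a ℕ.* d ℕ.+ b ℕ.* c) eq ⟩
    (a ℕ.* c ℕ.+ b ℕ.* d) ⊖ (a ℕ.* d ℕ.+ b ℕ.* c)
      ≈⟨ ⊖-* a b c d ⟩
    (a ⊖ b) * (c ⊖ d)
      ≈⟨ *-cong (⟦⟧-as-difference i) (⟦⟧-as-difference j) ⟨
    ⟦ i ⟧ * ⟦ j ⟧ ∎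
    where
    a = positivePart i; b = negativePart i; c = positivePart j; d = negativePart j
    eq = ≡.trans (≡.cong₂ ℤ._*_ (as-difference i) (as-difference j)) (product-of-differences a b c d)

  ⟦⟧-neg : ∀ i → ⟦ ℤ.- i ⟧ ≈ - ⟦ i ⟧
  ⟦⟧-neg i = begin
    ⟦ ℤ.- i ⟧   ≈⟨ ⟦⟧-difference b a eq ⟩
    b ⊖ a       ≈⟨ swap-difference (a × 1#) (b × 1#) ⟩
    - (a ⊖ b)   ≈⟨ -‿cong (⟦⟧-as-difference i) ⟨
    - ⟦ i ⟧     ∎
    where
    a = positivePart i; b = negativePart i
    eq = ≡.trans (≡.cong ℤ.-_ (as-difference i)) (negation-of-difference a b)

  homomorphism : CommutativeRing.rawRing ℤ.+-*-commutativeRing -Raw-AlmostCommutative⟶ fromCommutativeRing R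
  homomorphism = record
    { ⟦_⟧ = ⟦_⟧ ; +-homo = ⟦⟧-+ ; *-homo = ⟦⟧-* ; -‿homo = ⟦⟧-neg ; 0-homo = refl ; 1-homo = refl }

  constants-equal? : ∀ i j → Maybe (⟦ i ⟧ ≈ ⟦ j ⟧)
  constants-equal? i j with i ℤ.≟ j
  ... | yes ≡.refl = just refl
  ... | no _       = nothing

  private
    module Solver = Algebra.Solver.Ring (CommutativeRing.rawRing ℤ.+-*-commutativeRing) (fromCommutativeRing R)
                                         homomorphism constants-equal?
  open Solver using (Polynomial; con)
  open Solver public using (solve; _:=_; _:+_; _:*_; _:-_; :-_)

  :0 :1 : ∀ {k} → Polynomial k
  :0 = con ℤ.0ℤ
  :1 = con ℤ.1ℤ

module Counting where
  open import Data.Nat using (zero; suc; _+_; _*_)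
  import Data.Nat.Properties as ℕ
  open import Algebra.Properties.Semiring.Sum ℕ.+-*-semiring
    using (sum-syntax; sum-cong-≗; sum-replicate-zero; ∑-distrib-+; *-distribˡ-sum; *-distribʳ-sum)
  open import Data.Fin as Fin using (Fin; zero; suc; splitAt; join; _↑ˡ_; _↑ʳ_)
  import Data.Fin.Properties as Fin
  open import Data.Vec using (Vec; []; _∷_; head)
  import Data.Vec.Properties as Vec
  open import Data.Product using (∃; _×_; _,_; proj₁; proj₂)
  open import Data.Sum using (_⊎_; inj₁; inj₂; [_,_]′)
  open import Data.Empty using (⊥; ⊥-elim)
  open import Function using (_∘_)
  open import Function.Bundles using (Inverse)
  open import Relation.Nullary using (¬_; Dec; yes; no)
  open import Relation.Nullary.Decidable using (¬?; _×-dec_; _⊎-dec_)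
  open import Relation.Unary using (Decidable)
  open ≡ using (refl; sym; trans; cong; subst)

  module _ {A : Set} where

    -- Counts are unique: two enumerations of the same predicate inject into each other.
    HasCount-unique : ∀ {P : A → Set} {a b} → HasCount P a → HasCount P b → a ≡ b
    HasCount-unique {P} (f , f-inj , fP , f-onto) (g , g-inj , gP , g-onto) =
      ℕ.≤-antisym (Fin.injective⇒≤ (compare-inj f-inj g-onto fP)) (Fin.injective⇒≤ (compare-inj g-inj f-onto gP))
      where
      compare-inj : ∀ {m n} {f : Fin m → A} {g : Fin n → A} → (∀ {i j} → f i ≡ f j → i ≡ j) →
                    (onto : ∀ a → P a → ∃ λ k → g k ≡ a) → (fP : ∀ i → P (f i)) →
                    ∀ {i j} → proj₁ (onto (f i) (fP i)) ≡ proj₁ (onto (f j) (fP j)) → i ≡ j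
      compare-inj {f = f} {g} f-inj onto fP {i} {j} eq =
        f-inj (trans (sym (proj₂ (onto (f i) (fP i)))) (trans (cong g eq) (proj₂ (onto (f j) (fP j)))))

    HasCount-⇔ : ∀ {P Q : A → Set} {a} → (∀ x → P x → Q x) → (∀ x → Q x → P x) → HasCount P a → HasCount Q a
    HasCount-⇔ P⇒Q Q⇒P (f , f-inj , fP , f-onto) = f , f-inj , (λ i → P⇒Q _ (fP i)) , (λ x q → f-onto x (Q⇒P x q))

    HasCount-empty : ∀ {P : A → Set} → (∀ x → ¬ P x) → HasCount P 0
    HasCount-empty ¬P = (λ ()) , (λ {i} → ⊥-elim (Fin.¬Fin0 i)) , (λ ()) , (λ x p → ⊥-elim (¬P x p))

    HasCount-single : ∀ {P : A → Set} x → P x → (∀ y → P y → y ≡ x) → HasCount P 1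
    HasCount-single x px unique = (λ _ → x) , (λ {i} {j} _ → Fin1-unique i j) , (λ _ → px) , (λ y p → zero , sym (unique y p))
      where
      Fin1-unique : (i j : Fin 1) → i ≡ j
      Fin1-unique zero zero = refl

    HasCount-⊎ : ∀ {P Q : A → Set} {a b} → (∀ x → P x → Q x → ⊥) → HasCount P a → HasCount Q b →
                 HasCount (λ x → P x ⊎ Q x) (a + b)
    HasCount-⊎ {P} {Q} {a} {b} disjoint (f , f-inj , fP , f-onto) (g , g-inj , gQ , g-onto) =
      h , h-inj , h-sound , h-onto
      where
      f⊎g : Fin a ⊎ Fin b → A
      f⊎g = [ f , g ]′
      f⊎g-inj : ∀ u v → f⊎g u ≡ f⊎g v → u ≡ v
      f⊎g-inj (inj₁ i) (inj₁ j) e = cong inj₁ (f-inj e)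
      f⊎g-inj (inj₁ i) (inj₂ j) e = ⊥-elim (disjoint (f i) (fP i) (subst Q (sym e) (gQ j)))
      f⊎g-inj (inj₂ i) (inj₁ j) e = ⊥-elim (disjoint (f j) (fP j) (subst Q e (gQ i)))
      f⊎g-inj (inj₂ i) (inj₂ j) e = cong inj₂ (g-inj e)
      h : Fin (a + b) → A
      h = f⊎g ∘ splitAt a
      h-inj : ∀ {k l} → h k ≡ h l → k ≡ l
      h-inj {k} {l} e = trans (sym (Fin.join-splitAt a b k))
        (trans (cong (join a b) (f⊎g-inj (splitAt a k) (splitAt a l) e)) (Fin.join-splitAt a b l))
      h-sound : ∀ k → P (h k) ⊎ Q (h k)
      h-sound k with splitAt a k
      ... | inj₁ i = inj₁ (fP i)
      ... | inj₂ j = inj₂ (gQ j)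
      h-onto : ∀ x → P x ⊎ Q x → ∃ λ k → h k ≡ x
      h-onto x (inj₁ p) = let (i , e) = f-onto x p in i ↑ˡ b , trans (cong f⊎g (Fin.splitAt-↑ˡ a i b)) e
      h-onto x (inj₂ q) = let (j , e) = g-onto x q in a ↑ʳ j , trans (cong f⊎g (Fin.splitAt-↑ʳ a b j)) e

    HasCount-⋃ : ∀ {m} (P : Fin m → A → Set) (c : Fin m → ℕ) → (∀ {i j x} → P i x → P j x → i ≡ j) →
                 (∀ i → HasCount (P i) (c i)) → HasCount (λ x → ∃ λ i → P i x) (∑[ i < m ] c i)
    HasCount-⋃ {zero}  P c disjoint counts = HasCount-empty (λ { x (() , _) })
    HasCount-⋃ {suc m} P c disjoint counts =
      HasCount-⇔ merge split
        (HasCount-⊎ (λ x p q → Fin.0≢1+n (disjoint p (proj₂ q)))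
          (counts zero) (HasCount-⋃ (P ∘ suc) (c ∘ suc) (λ p q → Fin.suc-injective (disjoint p q)) (counts ∘ suc)))
      where
      merge : ∀ x → P zero x ⊎ (∃ λ i → P (suc i) x) → ∃ λ i → P i x
      merge x (inj₁ p)       = zero , p
      merge x (inj₂ (i , p)) = suc i , p
      split : ∀ x → (∃ λ i → P i x) → P zero x ⊎ (∃ λ i → P (suc i) x)
      split x (zero , p)  = inj₁ p
      split x (suc i , p) = inj₂ (i , p)

  𝟙 : ∀ {P : Set} → Dec P → ℕ
  𝟙 (yes _) = 1
  𝟙 (no _)  = 0

  module _ {P : Set} where

    𝟙-yes : (p? : Dec P) → P → 𝟙 p? ≡ 1
    𝟙-yes (yes _) _ = refl
    𝟙-yes (no ¬p) p = ⊥-elim (¬p p)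

    𝟙-no : (p? : Dec P) → ¬ P → 𝟙 p? ≡ 0
    𝟙-no (yes p) ¬p = ⊥-elim (¬p p)
    𝟙-no (no _)  _  = refl

    𝟙-⇔ : ∀ {Q : Set} (p? : Dec P) (q? : Dec Q) → (P → Q) → (Q → P) → 𝟙 p? ≡ 𝟙 q?
    𝟙-⇔ p? (yes q) _   Q⇒P = 𝟙-yes p? (Q⇒P q)
    𝟙-⇔ p? (no ¬q) P⇒Q _   = 𝟙-no p? (¬q ∘ P⇒Q)

    𝟙-complement : (p? : Dec P) → 𝟙 p? + 𝟙 (¬? p?) ≡ 1
    𝟙-complement (yes _) = refl
    𝟙-complement (no _)  = refl

    𝟙-⊎ : ∀ {Q : Set} (p? : Dec P) (q? : Dec Q) → (P → Q → ⊥) → 𝟙 (p? ⊎-dec q?) ≡ 𝟙 p? + 𝟙 q?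
    𝟙-⊎ (yes p) (yes q) disjoint = ⊥-elim (disjoint p q)
    𝟙-⊎ (yes _) (no _)  _        = refl
    𝟙-⊎ (no _)  (yes _) _        = refl
    𝟙-⊎ (no _)  (no _)  _        = refl

    𝟙-× : ∀ {Q : Set} (p? : Dec P) (q? : Dec Q) → 𝟙 (p? ×-dec q?) ≡ 𝟙 p? * 𝟙 q?
    𝟙-× (yes _) (yes _) = refl
    𝟙-× (yes _) (no _)  = refl
    𝟙-× (no _)  _       = refl

  ∑-cong : ∀ {m} {f g : Fin m → ℕ} → (∀ i → f i ≡ g i) → ∑[ i < m ] f i ≡ ∑[ i < m ] g i
  ∑-cong = sum-cong-≗

  ∑-1 : ∀ m → ∑[ i < m ] 1 ≡ m
  ∑-1 zero    = refl
  ∑-1 (suc m) = cong suc (∑-1 m)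

  ∑-δ : ∀ {m} (k : Fin m) → ∑[ i < m ] 𝟙 (i Fin.≟ k) ≡ 1
  ∑-δ {suc m} zero    =
    cong suc (trans (∑-cong {m} {g = λ _ → 0} (λ i → 𝟙-no (suc i Fin.≟ zero) (λ ()))) (sum-replicate-zero m))
  ∑-δ {suc m} (suc k) = trans (∑-cong (λ i → 𝟙-⇔ (suc i Fin.≟ suc k) (i Fin.≟ k) Fin.suc-injective (cong suc))) (∑-δ k)

  module Enumerated {C : Set} {q : ℕ} (enumeration : C ↔ Fin q) where
    open Inverse enumeration using (to; from; strictlyInverseˡ; strictlyInverseʳ)

    from-injective : ∀ {i j} → from i ≡ from j → i ≡ j
    from-injective {i} {j} e = trans (sym (strictlyInverseˡ i)) (trans (cong to e) (strictlyInverseˡ j))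

    infix 4 _≟_
    _≟_ : DecidableEquality C
    x ≟ y with to x Fin.≟ to y
    ... | yes e = yes (trans (sym (strictlyInverseʳ x)) (trans (cong from e) (strictlyInverseʳ y)))
    ... | no ne = no (ne ∘ cong to)

    ∑ᶜ : (C → ℕ) → ℕ
    ∑ᶜ f = ∑[ i < q ] f (from i)

    ∑ᶜ-cong : ∀ {f g : C → ℕ} → (∀ x → f x ≡ g x) → ∑ᶜ f ≡ ∑ᶜ g
    ∑ᶜ-cong f≗g = ∑-cong (f≗g ∘ from)

    ∑ᶜ-+ : ∀ (f g : C → ℕ) → ∑ᶜ (λ x → f x + g x) ≡ ∑ᶜ f + ∑ᶜ g
    ∑ᶜ-+ f g = ∑-distrib-+ (f ∘ from) (g ∘ from)

    ∑ᶜ-*ʳ : ∀ (f : C → ℕ) k → ∑ᶜ (λ x → f x * k) ≡ ∑ᶜ f * k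
    ∑ᶜ-*ʳ f k = sym (*-distribʳ-sum k (f ∘ from))

    ∑ᶜ-δ : ∀ a → ∑ᶜ (λ x → 𝟙 (x ≟ a)) ≡ 1
    ∑ᶜ-δ a = trans (∑-cong λ i → 𝟙-⇔ (from i ≟ a) (i Fin.≟ to a)
                      (λ e → trans (sym (strictlyInverseˡ i)) (cong to e)) (λ e → trans (cong from e) (strictlyInverseʳ a)))
                   (∑-δ (to a))

    ∑ᶜ-≢ : ∀ a → 1 + ∑ᶜ (λ x → 𝟙 (¬? (x ≟ a))) ≡ q
    ∑ᶜ-≢ a = begin
      1 + ∑ᶜ (λ x → 𝟙 (¬? (x ≟ a)))                  ≡⟨ cong (_+ ∑ᶜ (λ x → 𝟙 (¬? (x ≟ a)))) (∑ᶜ-δ a) ⟨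
      ∑ᶜ (λ x → 𝟙 (x ≟ a)) + ∑ᶜ (λ x → 𝟙 (¬? (x ≟ a)))  ≡⟨ ∑ᶜ-+ (λ x → 𝟙 (x ≟ a)) (λ x → 𝟙 (¬? (x ≟ a))) ⟨
      ∑ᶜ (λ x → 𝟙 (x ≟ a) + 𝟙 (¬? (x ≟ a)))          ≡⟨ ∑ᶜ-cong (λ x → 𝟙-complement (x ≟ a)) ⟩
      ∑[ i < q ] 1                                     ≡⟨ ∑-1 q ⟩
      q                                                ∎
      where open ≡.≡-Reasoning

    count : ∀ n → (Vec C n → ℕ) → ℕ
    count zero    f = f []
    count (suc n) f = ∑ᶜ (λ x → count n (λ v → f (x ∷ v)))

    count-cong : ∀ n {f g : Vec C n → ℕ} → (∀ v → f v ≡ g v) → count n f ≡ count n g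
    count-cong zero    f≗g = f≗g []
    count-cong (suc n) f≗g = ∑-cong (λ i → count-cong n (λ v → f≗g (from i ∷ v)))

    count-+ : ∀ n (f g : Vec C n → ℕ) → count n (λ v → f v + g v) ≡ count n f + count n g
    count-+ zero    f g = refl
    count-+ (suc n) f g = trans (∑-cong (λ i → count-+ n (λ v → f (from i ∷ v)) (λ v → g (from i ∷ v))))
                                (∑-distrib-+ (λ i → count n (λ v → f (from i ∷ v))) (λ i → count n (λ v → g (from i ∷ v))))

    count-* : ∀ n k (f : Vec C n → ℕ) → count n (λ v → k * f v) ≡ k * count n f
    count-* zero    k f = refl
    count-* (suc n) k f = trans (∑-cong (λ i → count-* n k (λ v → f (from i ∷ v))))
                                (sym (*-distribˡ-sum k (λ i → count n (λ v → f (from i ∷ v)))))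

    HasCount-head : ∀ {n} (P : Vec C (suc n) → Set) x {k} → HasCount (λ w → P (x ∷ w)) k →
                    HasCount (λ v → P v × head v ≡ x) k
    HasCount-head P x (f , f-inj , fP , f-onto) = (x ∷_) ∘ f , f-inj ∘ Vec.∷-injectiveʳ , (λ i → fP i , refl) , onto
      where
      onto : ∀ v → P v × head v ≡ x → ∃ λ i → x ∷ f i ≡ v
      onto (y ∷ w) (p , refl) = let (i , e) = f-onto w p in i , cong (y ∷_) e

    HasCount-count : ∀ n (P : Vec C n → Set) (P? : Decidable P) → HasCount P (count n (λ v → 𝟙 (P? v)))
    HasCount-count zero P P? with P? []
    ... | yes p = HasCount-single [] p (λ { [] _ → refl })
    ... | no ¬p = HasCount-empty (λ { [] → ¬p })
    HasCount-count (suc n) P P? =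
      HasCount-⇔ (λ v → proj₁ ∘ proj₂) (λ v p → to (head v) , p , sym (strictlyInverseʳ (head v)))
        (HasCount-⋃ (λ i v → P v × head v ≡ from i) _ (λ (_ , e) (_ , e′) → from-injective (trans (sym e) e′))
          (λ i → HasCount-head P (from i) (HasCount-count n (λ w → P (from i ∷ w)) (λ w → P? (from i ∷ w)))))

    count-∷ : ∀ n (f : Vec C (suc n) → ℕ) (g : C → ℕ) (h : C → Vec C n → ℕ) →
              (∀ x v → f (x ∷ v) ≡ g x * h x v) → count (suc n) f ≡ ∑ᶜ (λ x → g x * count n (h x))
    count-∷ n f g h f≡gh = ∑-cong (λ i → trans (count-cong n (f≡gh (from i))) (count-* n (g (from i)) (h (from i))))

-- Arithmetic in a field with decidable equality that coincides with
-- propositional equality; the inverse is extended by 0⁻¹ = 0.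
module FieldArithmetic
  (F : CommutativeRing 0ℓ 0ℓ) (isField : IsField F)
  (≈⇒≡ : ∀ {x y} → CommutativeRing._≈_ F x y → x ≡ y)
  (_≟_ : DecidableEquality (CommutativeRing.Carrier F)) where

  open import Data.Product using (proj₁; proj₂)
  open import Data.Empty using (⊥-elim)
  open import Function using (_∘_)
  open import Relation.Nullary using (yes; no)
  open ≡ using (cong; _≢_)
  open ≡.≡-Reasoning
  open CommutativeRing F hiding (refl; sym; trans; reflexive)
  open IntegerSolver F using (solve; _:=_; _:+_; _:*_; _:-_)

  ≈-refl : ∀ {x} → x ≈ x
  ≈-refl = CommutativeRing.refl F

  0≢1 : 0# ≢ 1#
  0≢1 e = proj₁ isField (CommutativeRing.reflexive F e)

  _⁻¹ : Carrier → Carrier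
  x ⁻¹ with x ≟ 0#
  ... | yes _   = 0#
  ... | no x≢0 = proj₁ (proj₂ isField x (x≢0 ∘ ≈⇒≡))

  ⁻¹-inverse : ∀ x → x ≢ 0# → x * x ⁻¹ ≡ 1#
  ⁻¹-inverse x x≢0 with x ≟ 0#
  ... | yes x≡0 = ⊥-elim (x≢0 x≡0)
  ... | no x≢0′ = ≈⇒≡ (proj₂ (proj₂ isField x (x≢0′ ∘ ≈⇒≡)))

  ⁻¹-nonzero : ∀ x → x ≢ 0# → x ⁻¹ ≢ 0#
  ⁻¹-nonzero x x≢0 x⁻¹≡0 = 0≢1 (begin
    0#          ≡⟨ ≈⇒≡ (zeroʳ x) ⟨
    x * 0#      ≡⟨ cong (x *_) x⁻¹≡0 ⟨
    x * x ⁻¹    ≡⟨ ⁻¹-inverse x x≢0 ⟩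
    1#          ∎)

  ⁻¹-involutive : ∀ x → x ≢ 0# → x ⁻¹ ⁻¹ ≡ x
  ⁻¹-involutive x x≢0 = begin
    y ⁻¹              ≡⟨ ≈⇒≡ (*-identityʳ (y ⁻¹)) ⟨
    y ⁻¹ * 1#         ≡⟨ cong (y ⁻¹ *_) (⁻¹-inverse x x≢0) ⟨
    y ⁻¹ * (x * y)    ≡⟨ ≈⇒≡ (solve 3 (λ a b c → a :* (b :* c) := b :* (c :* a)) ≈-refl (y ⁻¹) x y) ⟩
    x * (y * y ⁻¹)    ≡⟨ cong (x *_) (⁻¹-inverse y (⁻¹-nonzero x x≢0)) ⟩
    x * 1#            ≡⟨ ≈⇒≡ (*-identityʳ x) ⟩
    x                 ∎
    where y = x ⁻¹

  -1≢0 : - 1# ≢ 0#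
  -1≢0 -1≡0 = 0≢1 (begin
    0#          ≡⟨ ≈⇒≡ (-‿inverseʳ 1#) ⟨
    1# + - 1#   ≡⟨ cong (1# +_) -1≡0 ⟩
    1# + 0#     ≡⟨ ≈⇒≡ (+-identityʳ 1#) ⟩
    1#          ∎)

  difference-zero : ∀ a b → a - b ≡ 0# → a ≡ b
  difference-zero a b a-b≡0 = begin
    a              ≡⟨ ≈⇒≡ (solve 2 (λ a b → a := (a :- b) :+ b) ≈-refl a b) ⟩
    (a - b) + b    ≡⟨ cong (_+ b) a-b≡0 ⟩
    0# + b         ≡⟨ ≈⇒≡ (+-identityˡ b) ⟩
    b              ∎

module Matrices (F : CommutativeRing 0ℓ 0ℓ) (≈⇒≡ : ∀ {x y} → CommutativeRing._≈_ F x y → x ≡ y) where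

  open import Data.Nat using (zero; suc)
  open import Data.Fin as Fin using (zero; suc)
  import Data.Fin.Properties as Fin
  open import Data.Product using (_,_)
  open import Data.Empty using (⊥-elim)
  open import Function using (_∘_)
  open import Relation.Nullary using (¬_; Dec; yes; no)
  open ≡ using (refl; sym; trans; cong; cong₂; _≢_)
  open ≡.≡-Reasoning
  open CommutativeRing F hiding (refl; sym; trans; reflexive; zero)
  open import Algebra.Properties.Semiring.Sum semiring
    using (sum-syntax; sum-cong-≗; sum-replicate-zero; ∑-distrib-+; ∑-comm; *-distribˡ-sum; *-distribʳ-sum)

  sumFin≡∑ : ∀ {n} (f : Fin n → Carrier) → sumFin F f ≡ ∑[ k < n ] f k
  sumFin≡∑ {zero}  f = refl
  sumFin≡∑ {suc n} f = cong (f zero +_) (sumFin≡∑ (f ∘ suc))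

  ∑-cong : ∀ {n} {f g : Fin n → Carrier} → (∀ i → f i ≡ g i) → ∑[ i < n ] f i ≡ ∑[ i < n ] g i
  ∑-cong = sum-cong-≗

  ∑-0 : ∀ n → ∑[ i < n ] 0# ≡ 0#
  ∑-0 n = ≈⇒≡ (sum-replicate-zero n)

  ∑-+-scaled : ∀ {n} (f x : Fin n → Carrier) a → ∑[ k < n ] (f k + x k * a) ≡ ∑[ k < n ] f k + ∑[ k < n ] x k * a
  ∑-+-scaled {n} f x a = trans (≈⇒≡ (∑-distrib-+ f (λ k → x k * a)))
                               (cong (∑[ k < n ] f k +_) (sym (≈⇒≡ (*-distribʳ-sum a x))))

  δ : ∀ {n} → Fin n → Fin n → Carrier
  δ = identity F

  δ-diag : ∀ {n} (i : Fin n) → δ i i ≡ 1#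
  δ-diag i with i Fin.≟ i
  ... | yes _  = refl
  ... | no i≢i = ⊥-elim (i≢i refl)

  δ-off : ∀ {n} {i j : Fin n} → i ≢ j → δ i j ≡ 0#
  δ-off {i = i} {j} i≢j with i Fin.≟ j
  ... | yes i≡j = ⊥-elim (i≢j i≡j)
  ... | no _    = refl

  δ-sym : ∀ {n} (i j : Fin n) → δ i j ≡ δ j i
  δ-sym i j with i Fin.≟ j
  ... | yes refl = sym (δ-diag i)
  ... | no i≢j   = sym (δ-off (i≢j ∘ sym))

  δ-suc : ∀ {n} (i j : Fin n) → δ (suc i) (suc j) ≡ δ i j
  δ-suc i j = by-cases (i Fin.≟ j)
    where
    by-cases : Dec (i ≡ j) → δ (suc i) (suc j) ≡ δ i j
    by-cases (yes refl) = trans (δ-diag (suc i)) (sym (δ-diag i))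
    by-cases (no i≢j)   = trans (δ-off (i≢j ∘ Fin.suc-injective)) (sym (δ-off i≢j))

  δ-select : ∀ {n} (i j : Fin n) (f : Fin n → Carrier) → δ i j * f i ≡ δ i j * f j
  δ-select i j f with i Fin.≟ j
  ... | yes refl = refl
  ... | no _     = trans (≈⇒≡ (zeroˡ (f i))) (sym (≈⇒≡ (zeroˡ (f j))))

  diagonal-symmetric : ∀ {n} (w : Fin n → Carrier) k j → w k * δ k j ≡ w j * δ j k
  diagonal-symmetric w k j = begin
    w k * δ k j   ≡⟨ ≈⇒≡ (*-comm (w k) (δ k j)) ⟩
    δ k j * w k   ≡⟨ δ-select k j w ⟩
    δ k j * w j   ≡⟨ cong (_* w j) (δ-sym k j) ⟩
    δ j k * w j   ≡⟨ ≈⇒≡ (*-comm (δ j k) (w j)) ⟩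
    w j * δ j k   ∎

  ∑-δ : ∀ {n} (j : Fin n) (f : Fin n → Carrier) → ∑[ k < n ] (δ j k * f k) ≡ f j
  ∑-δ {suc n} zero f = begin
    1# * f zero + ∑[ k < n ] (0# * f (suc k))
      ≡⟨ cong₂ _+_ (≈⇒≡ (*-identityˡ (f zero))) (∑-cong (λ k → ≈⇒≡ (zeroˡ (f (suc k))))) ⟩
    f zero + ∑[ k < n ] 0#
      ≡⟨ cong (f zero +_) (∑-0 n) ⟩
    f zero + 0#
      ≡⟨ ≈⇒≡ (+-identityʳ (f zero)) ⟩
    f zero ∎
  ∑-δ {suc n} (suc j) f = begin
    0# * f zero + ∑[ k < n ] (δ (suc j) (suc k) * f (suc k))
      ≡⟨ cong₂ _+_ (≈⇒≡ (zeroˡ (f zero))) (∑-cong (λ k → cong (_* f (suc k)) (δ-suc j k))) ⟩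
    0# + ∑[ k < n ] (δ j k * f (suc k))                      ≡⟨ ≈⇒≡ (+-identityˡ _) ⟩
    ∑[ k < n ] (δ j k * f (suc k))                           ≡⟨ ∑-δ j (f ∘ suc) ⟩
    f (suc j)                                                 ∎

  ∑-δʳ : ∀ {n} (j : Fin n) (f : Fin n → Carrier) → ∑[ k < n ] (f k * δ k j) ≡ f j
  ∑-δʳ j f = trans (∑-cong (λ k → trans (≈⇒≡ (*-comm (f k) (δ k j))) (cong (_* f k) (δ-sym k j)))) (∑-δ j f)

  ⊗-entry : ∀ {n} (M B : Matrix F n) i j → _⊗_ F M B i j ≡ ∑[ k < n ] (M i k * B k j)
  ⊗-entry M B i j = sumFin≡∑ (λ k → M i k * B k j)

  -- Over a nontrivial ring two equal rows make a matrix singular: they would give δ j i = δ i i.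
  equal-rows⇒singular : 0# ≢ 1# → ∀ {n} (M : Matrix F n) {i j} → i ≢ j → (∀ k → M i k ≡ M j k) → ¬ Invertible F M
  equal-rows⇒singular 0≢1 {n} M {i} {j} i≢j same-rows (B , MB≋I , _) = 0≢1 (begin
    0#                          ≡⟨ δ-off (i≢j ∘ sym) ⟨
    δ j i                       ≡⟨ ≈⇒≡ (MB≋I j i) ⟨
    _⊗_ F M B j i               ≡⟨ ⊗-entry M B j i ⟩
    ∑[ k < n ] (M j k * B k i)  ≡⟨ ∑-cong (λ k → cong (_* B k i) (same-rows k)) ⟨
    ∑[ k < n ] (M i k * B k i)  ≡⟨ ⊗-entry M B i i ⟨
    _⊗_ F M B i i               ≡⟨ ≈⇒≡ (MB≋I i i) ⟩
    δ i i                       ≡⟨ δ-diag i ⟩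
    1#                          ∎)

  -- An invertible matrix has trivial left kernel: from c M = 0 we get c = c M B = 0.
  left-kernel-trivial : ∀ {n} (M : Matrix F n) → Invertible F M → (c : Fin n → Carrier) →
                        (∀ k → ∑[ i < n ] (c i * M i k) ≡ 0#) → ∀ j → c j ≡ 0#
  left-kernel-trivial {n} M (B , MB≋I , _) c cM≡0 j = begin
    c j
      ≡⟨ ∑-δʳ j c ⟨
    ∑[ i < n ] (c i * δ i j)
      ≡⟨ ∑-cong (λ i → cong (c i *_) (trans (sym (≈⇒≡ (MB≋I i j))) (⊗-entry M B i j))) ⟩
    ∑[ i < n ] (c i * ∑[ k < n ] (M i k * B k j))
      ≡⟨ ∑-cong (λ i → ≈⇒≡ (*-distribˡ-sum (c i) (λ k → M i k * B k j))) ⟩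
    ∑[ i < n ] ∑[ k < n ] (c i * (M i k * B k j))
      ≡⟨ ≈⇒≡ (∑-comm (λ i k → c i * (M i k * B k j))) ⟩
    ∑[ k < n ] ∑[ i < n ] (c i * (M i k * B k j))
      ≡⟨ ∑-cong (λ k → ∑-cong (λ i → ≈⇒≡ (*-assoc (c i) (M i k) (B k j)))) ⟨
    ∑[ k < n ] ∑[ i < n ] (c i * M i k * B k j)
      ≡⟨ ∑-cong (λ k → ≈⇒≡ (*-distribʳ-sum (B k j) (λ i → c i * M i k))) ⟨
    ∑[ k < n ] (∑[ i < n ] (c i * M i k) * B k j)
      ≡⟨ ∑-cong (λ k → trans (cong (_* B k j) (cM≡0 k)) (≈⇒≡ (zeroˡ (B k j)))) ⟩
    ∑[ k < n ] 0#
      ≡⟨ ∑-0 n ⟩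
    0# ∎

  -- For symmetric M, a symmetric right inverse B is also a left inverse: (B M)ᵢⱼ = (M B)ⱼᵢ.
  symmetric-inverse : ∀ {n} (M B : Matrix F n) → (∀ i j → M i j ≡ M j i) → (∀ i j → B i j ≡ B j i) →
                      (∀ i j → ∑[ k < n ] (M i k * B k j) ≡ δ i j) → Invertible F M
  symmetric-inverse {n} M B M-sym B-sym MB≡I = B , right , left
    where
    right : _≋_ F (_⊗_ F M B) (identity F)
    right i j = CommutativeRing.reflexive F (trans (⊗-entry M B i j) (MB≡I i j))
    left : _≋_ F (_⊗_ F B M) (identity F)
    left i j = CommutativeRing.reflexive F (begin
      _⊗_ F B M i j
        ≡⟨ ⊗-entry B M i j ⟩
      ∑[ k < n ] (B i k * M k j)
        ≡⟨ ∑-cong (λ k → trans (cong₂ _*_ (B-sym i k) (M-sym k j)) (≈⇒≡ (*-comm (B k i) (M j k)))) ⟩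
      ∑[ k < n ] (M j k * B k i)
        ≡⟨ MB≡I j i ⟩
      δ j i
        ≡⟨ δ-sym j i ⟩
      δ i j ∎)

module SchrodingerInvertibility
  (F : CommutativeRing 0ℓ 0ℓ) (isField : IsField F)
  (≈⇒≡ : ∀ {x y} → CommutativeRing._≈_ F x y → x ≡ y)
  (_≟_ : DecidableEquality (CommutativeRing.Carrier F)) where

  open import Data.Nat using (zero; suc)
  import Data.Nat.Properties as ℕ
  open import Data.Fin as Fin using (Fin; zero; suc)
  import Data.Fin.Properties as Fin
  open import Data.Vec using (Vec; []; _∷_; lookup)
  open import Data.Product using (∃; _×_; _,_)
  open import Data.Sum using (_⊎_; inj₁; inj₂)
  open import Data.Empty using (⊥-elim)
  open import Function using (_∘_)
  open import Relation.Nullary using (¬_; yes; no)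
  open ≡ using (refl; sym; trans; cong; cong₂; _≢_)
  open ≡.≡-Reasoning

  open CommutativeRing F hiding (refl; sym; trans; reflexive; zero)
  open import Algebra.Properties.Semiring.Sum semiring using (sum-syntax; ∑-distrib-+)
  open IntegerSolver F using (solve; _:=_; _:+_; _:*_; _:-_; :-_; :0; :1)
  open Counting using (𝟙)
  open FieldArithmetic F isField ≈⇒≡ _≟_
  open Matrices F ≈⇒≡

  shift : ∀ {n} → Vec Carrier n → Fin n → Carrier
  shift d i = lookup d i - 1#

  M-entry : ∀ {n} (d : Vec Carrier n) i j → schrodingerK F d i j ≡ 1# + δ i j * shift d i
  M-entry d i j with i Fin.≟ j
  ... | yes refl = ≈⇒≡ (solve 1 (λ a → :0 :+ a := :1 :+ :1 :* (a :- :1)) ≈-refl (lookup d i))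
  ... | no _     = ≈⇒≡ (solve 1 (λ a → :1 :+ :0 := :1 :+ :0 :* a) ≈-refl (shift d i))

  M-symmetric : ∀ {n} (d : Vec Carrier n) i j → schrodingerK F d i j ≡ schrodingerK F d j i
  M-symmetric d i j = begin
    schrodingerK F d i j      ≡⟨ M-entry d i j ⟩
    1# + δ i j * shift d i    ≡⟨ cong (1# +_) (δ-select i j (shift d)) ⟩
    1# + δ i j * shift d j    ≡⟨ cong (λ x → 1# + x * shift d j) (δ-sym i j) ⟩
    1# + δ j i * shift d j    ≡⟨ M-entry d j i ⟨
    schrodingerK F d j i      ∎

  row-combination : ∀ {n} (d : Vec Carrier n) (c : Fin n → Carrier) k →
                    ∑[ i < n ] (c i * schrodingerK F d i k) ≡ ∑[ i < n ] c i + c k * shift d k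
  row-combination {n} d c k = begin
    ∑[ i < n ] (c i * schrodingerK F d i k)
      ≡⟨ ∑-cong (λ i → trans (cong (c i *_) (M-entry d i k)) (expand (c i) (δ i k) (shift d i))) ⟩
    ∑[ i < n ] (c i + c i * shift d i * δ i k)
      ≡⟨ ≈⇒≡ (∑-distrib-+ c (λ i → c i * shift d i * δ i k)) ⟩
    ∑[ i < n ] c i + ∑[ i < n ] (c i * shift d i * δ i k)
      ≡⟨ cong (∑[ i < n ] c i +_) (∑-δʳ k (λ i → c i * shift d i)) ⟩
    ∑[ i < n ] c i + c k * shift d k ∎
    where
    expand : ∀ a b e → a * (1# + b * e) ≡ a + a * e * b
    expand a b e = ≈⇒≡ (solve 3 (λ a b e → a :* (:1 :+ b :* e) := a :+ a :* e :* b) ≈-refl a b e)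

  column-combination : ∀ {n} (d : Vec Carrier n) (b : Fin n → Carrier) i →
                       ∑[ k < n ] (schrodingerK F d i k * b k) ≡ ∑[ k < n ] b k + shift d i * b i
  column-combination {n} d b i = begin
    ∑[ k < n ] (schrodingerK F d i k * b k)
      ≡⟨ ∑-cong (λ k → trans (cong (_* b k) (M-entry d i k)) (expand (b k) (δ i k) (shift d i))) ⟩
    ∑[ k < n ] (b k + δ i k * (shift d i * b k))
      ≡⟨ ≈⇒≡ (∑-distrib-+ b (λ k → δ i k * (shift d i * b k))) ⟩
    ∑[ k < n ] b k + ∑[ k < n ] (δ i k * (shift d i * b k))
      ≡⟨ cong (∑[ k < n ] b k +_) (∑-δ i (λ k → shift d i * b k)) ⟩
    ∑[ k < n ] b k + shift d i * b i ∎
    where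
    expand : ∀ a b e → (1# + b * e) * a ≡ a + b * (e * a)
    expand a b e = ≈⇒≡ (solve 3 (λ a b e → (:1 :+ b :* e) :* a := a :+ b :* (e :* a)) ≈-refl a b e)

  w : ∀ {n} → Vec Carrier n → Fin n → Carrier
  w d i = shift d i ⁻¹

  σ : ∀ {n} → Vec Carrier n → Carrier
  σ {n} d = ∑[ i < n ] w d i

  shift-nonzero : ∀ {n} (d : Vec Carrier n) i → lookup d i ≢ 1# → shift d i ≢ 0#
  shift-nonzero d i dᵢ≢1 = dᵢ≢1 ∘ difference-zero (lookup d i) 1#

  -- If no dᵢ is 1 and 1 + σ = 0, then w ≠ 0 lies in the left kernel.
  balanced⇒singular : ∀ {n} (d : Vec Carrier n) → (∀ i → lookup d i ≢ 1#) → 1# + σ d ≡ 0# →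
                      ¬ Invertible F (schrodingerK F d)
  balanced⇒singular {zero}  d no-ones 1+σ≡0 _ = 0≢1 (trans (sym 1+σ≡0) (≈⇒≡ (+-identityʳ 1#)))
  balanced⇒singular {suc n} d no-ones 1+σ≡0 invertible =
    ⁻¹-nonzero (shift d zero) (e≢0 zero)
      (left-kernel-trivial (schrodingerK F d) invertible (w d) wM≡0 zero)
    where
    e≢0 : ∀ k → shift d k ≢ 0#
    e≢0 k = shift-nonzero d k (no-ones k)
    wM≡0 : ∀ k → ∑[ i < suc n ] (w d i * schrodingerK F d i k) ≡ 0#
    wM≡0 k = begin
      ∑[ i < suc n ] (w d i * schrodingerK F d i k)
        ≡⟨ row-combination d (w d) k ⟩
      σ d + w d k * shift d k
        ≡⟨ cong (σ d +_) (trans (≈⇒≡ (*-comm (w d k) (shift d k))) (⁻¹-inverse (shift d k) (e≢0 k))) ⟩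
      σ d + 1#
        ≡⟨ ≈⇒≡ (+-comm (σ d) 1#) ⟩
      1# + σ d
        ≡⟨ 1+σ≡0 ⟩
      0# ∎

  -- If no dᵢ is 1 and 1 + σ ≠ 0, the inverse is diag(w) − t w wᵀ with t = (1 + σ)⁻¹
  -- (Sherman–Morrison).
  unbalanced⇒invertible : ∀ {n} (d : Vec Carrier n) → (∀ i → lookup d i ≢ 1#) → 1# + σ d ≢ 0# →
                          Invertible F (schrodingerK F d)
  unbalanced⇒invertible {n} d no-ones 1+σ≢0 = symmetric-inverse (schrodingerK F d) B (M-symmetric d) B-symmetric MB≡I
    where
    t : Carrier
    t = (1# + σ d) ⁻¹
    B : Matrix F n
    B k j = w d k * δ k j + w d k * - (t * w d j)
    B-symmetric : ∀ k j → B k j ≡ B j k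
    B-symmetric k j = cong₂ _+_ (diagonal-symmetric (w d) k j)
      (≈⇒≡ (solve 3 (λ a b t → a :* :- (t :* b) := b :* :- (t :* a)) ≈-refl (w d k) (w d j) t))
    MB≡I : ∀ i j → ∑[ k < n ] (schrodingerK F d i k * B k j) ≡ δ i j
    MB≡I i j = begin
      ∑[ k < n ] (schrodingerK F d i k * B k j)
        ≡⟨ column-combination d (λ k → B k j) i ⟩
      ∑[ k < n ] B k j + e * B i j
        ≡⟨ cong (_+ e * B i j) (∑-+-scaled (λ k → w d k * δ k j) (w d) (- (t * wj))) ⟩
      ∑[ k < n ] (w d k * δ k j) + σ d * - (t * wj) + e * B i j
        ≡⟨ cong (λ x → x + σ d * - (t * wj) + e * B i j) (∑-δʳ j (w d)) ⟩
      wj + σ d * - (t * wj) + e * (wi * δ i j + wi * - (t * wj))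
        ≡⟨ ≈⇒≡ (solve 6 (λ wj t σ e wi δ →
             wj :+ σ :* :- (t :* wj) :+ e :* (wi :* δ :+ wi :* :- (t :* wj))
             := wj :* (:1 :- t :* (:1 :+ σ)) :+ δ :* (e :* wi) :+ t :* wj :* (:1 :- e :* wi))
             ≈-refl wj t (σ d) e wi (δ i j)) ⟩
      wj * (1# - t * (1# + σ d)) + δ i j * (e * wi) + t * wj * (1# - e * wi)
        ≡⟨ cong₂ (λ x y → wj * (1# - x) + δ i j * y + t * wj * (1# - y))
             (trans (≈⇒≡ (*-comm t (1# + σ d))) (⁻¹-inverse (1# + σ d) 1+σ≢0))
             (⁻¹-inverse e (shift-nonzero d i (no-ones i))) ⟩
      wj * (1# - 1#) + δ i j * 1# + t * wj * (1# - 1#)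
        ≡⟨ ≈⇒≡ (solve 3 (λ wj δ t → wj :* (:1 :- :1) :+ δ :* :1 :+ t :* wj :* (:1 :- :1) := δ)
             ≈-refl wj (δ i j) t) ⟩
      δ i j ∎
      where e = shift d i; wi = w d i; wj = w d j

  -- If exactly one coordinate d_{k₀} is 1, the inverse is
  -- diag(w) − w uᵀ + u ((1 + σ) u − w)ᵀ with u = δ k₀ the k₀-th unit vector
  -- (here w_{k₀} = 0⁻¹ = 0).
  module UniqueOne {n : ℕ} (d : Vec Carrier n) (k₀ : Fin n)
                   (d₀≡1 : lookup d k₀ ≡ 1#) (unique : ∀ i → lookup d i ≡ 1# → i ≡ k₀) where

    u : Fin n → Carrier
    u i = δ i k₀

    e₀≡0 : shift d k₀ ≡ 0#
    e₀≡0 = trans (cong (_- 1#) d₀≡1) (≈⇒≡ (-‿inverseʳ 1#))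

    -- eᵢ wᵢ = 1 − uᵢ: for i ≠ k₀ because eᵢ ≠ 0, for i = k₀ because e_{k₀} = 0.
    ew≡1-u : ∀ i → shift d i * w d i ≡ 1# - u i
    ew≡1-u i with i Fin.≟ k₀
    ... | yes refl = trans (cong (_* w d k₀) e₀≡0) (≈⇒≡ (solve 1 (λ w → :0 :* w := :1 :- :1) ≈-refl (w d k₀)))
    ... | no i≢k₀  = trans (⁻¹-inverse (shift d i) (shift-nonzero d i (i≢k₀ ∘ unique i)))
                          (≈⇒≡ (solve 0 (:1 := :1 :- :0) ≈-refl))

    eu≡0 : ∀ i → shift d i * u i ≡ 0#
    eu≡0 i with i Fin.≟ k₀
    ... | yes refl = trans (cong (_* 1#) e₀≡0) (≈⇒≡ (zeroˡ 1#))
    ... | no _     = ≈⇒≡ (zeroʳ (shift d i))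

    uδ≡uu : ∀ i j → u i * δ i j ≡ u i * u j
    uδ≡uu i j = trans (δ-select i k₀ (λ x → δ x j)) (cong (u i *_) (δ-sym k₀ j))

    ∑u≡1 : ∑[ k < n ] u k ≡ 1#
    ∑u≡1 = trans (∑-cong (λ k → sym (≈⇒≡ (*-identityˡ (u k))))) (∑-δʳ k₀ (λ _ → 1#))

    b : Fin n → Carrier
    b j = u j * (1# + σ d) - w d j

    B : Matrix F n
    B i j = w d i * δ i j + w d i * - u j + u i * b j

    B-symmetric : ∀ i j → B i j ≡ B j i
    B-symmetric i j = trans (cong (λ x → x + w d i * - u j + u i * b j) (diagonal-symmetric (w d) i j))
      (≈⇒≡ (solve 6 (λ x wi wj ui uj σ → x :+ wi :* :- uj :+ ui :* (uj :* (:1 :+ σ) :- wj)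
                                      := x :+ wj :* :- ui :+ uj :* (ui :* (:1 :+ σ) :- wi))
                    ≈-refl (w d j * δ j i) (w d i) (w d j) (u i) (u j) (σ d)))

    column-sum : ∀ j → ∑[ k < n ] B k j ≡ w d j + σ d * - u j + 1# * b j
    column-sum j = begin
      ∑[ k < n ] B k j
        ≡⟨ ∑-+-scaled (λ k → w d k * δ k j + w d k * - u j) u (b j) ⟩
      ∑[ k < n ] (w d k * δ k j + w d k * - u j) + ∑[ k < n ] u k * b j
        ≡⟨ cong₂ (λ x y → x + y * b j) (∑-+-scaled (λ k → w d k * δ k j) (w d) (- u j)) ∑u≡1 ⟩
      ∑[ k < n ] (w d k * δ k j) + σ d * - u j + 1# * b j
        ≡⟨ cong (λ x → x + σ d * - u j + 1# * b j) (∑-δʳ j (w d)) ⟩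
      w d j + σ d * - u j + 1# * b j ∎

    MB≡I : ∀ i j → ∑[ k < n ] (schrodingerK F d i k * B k j) ≡ δ i j
    MB≡I i j = begin
      ∑[ k < n ] (schrodingerK F d i k * B k j)
        ≡⟨ column-combination d (λ k → B k j) i ⟩
      ∑[ k < n ] B k j + e * B i j
        ≡⟨ cong (_+ e * B i j) (column-sum j) ⟩
      wj + σ d * - uj + 1# * (uj * (1# + σ d) - wj) + e * (wi * δ i j + wi * - uj + ui * (uj * (1# + σ d) - wj))
        ≡⟨ ≈⇒≡ (solve 7 (λ wj σ uj e wi δ ui →
             wj :+ σ :* :- uj :+ :1 :* (uj :* (:1 :+ σ) :- wj) :+ e :* (wi :* δ :+ wi :* :- uj :+ ui :* (uj :* (:1 :+ σ) :- wj))
             := uj :+ (e :* wi) :* δ :+ (e :* wi) :* :- uj :+ (e :* ui) :* (uj :* (:1 :+ σ) :- wj))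
             ≈-refl wj (σ d) uj e wi (δ i j) ui) ⟩
      uj + (e * wi) * δ i j + (e * wi) * - uj + (e * ui) * b j
        ≡⟨ cong₂ (λ x y → uj + x * δ i j + x * - uj + y * b j) (ew≡1-u i) (eu≡0 i) ⟩
      uj + (1# - ui) * δ i j + (1# - ui) * - uj + 0# * b j
        ≡⟨ ≈⇒≡ (solve 4 (λ uj ui δ x → uj :+ (:1 :- ui) :* δ :+ (:1 :- ui) :* :- uj :+ :0 :* x
                                       := δ :+ ui :* uj :- ui :* δ) ≈-refl uj ui (δ i j) (b j)) ⟩
      δ i j + ui * uj - ui * δ i j
        ≡⟨ cong (λ x → δ i j + ui * uj - x) (uδ≡uu i j) ⟩
      δ i j + ui * uj - ui * uj
        ≡⟨ ≈⇒≡ (solve 2 (λ δ a → δ :+ a :- a := δ) ≈-refl (δ i j) (ui * uj)) ⟩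
      δ i j ∎
      where e = shift d i; wi = w d i; wj = w d j; ui = u i; uj = u j

  unique-one⇒invertible : ∀ {n} (d : Vec Carrier n) k₀ → lookup d k₀ ≡ 1# → (∀ i → lookup d i ≡ 1# → i ≡ k₀) →
                          Invertible F (schrodingerK F d)
  unique-one⇒invertible d k₀ d₀≡1 unique = symmetric-inverse (schrodingerK F d) B (M-symmetric d) B-symmetric MB≡I
    where open UniqueOne d k₀ d₀≡1 unique

  ones : ∀ {n} → Vec Carrier n → ℕ
  ones []      = 0
  ones (x ∷ v) = 𝟙 (x ≟ 1#) ℕ.+ ones v

  ones≡0 : ∀ {n} (d : Vec Carrier n) → ones d ≡ 0 → ∀ i → lookup d i ≢ 1#
  ones≡0 (x ∷ v) count≡0 i with x ≟ 1#
  ones≡0 (x ∷ v) ()      i       | yes _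
  ones≡0 (x ∷ v) count≡0 zero    | no x≢1 = x≢1
  ones≡0 (x ∷ v) count≡0 (suc i) | no _   = ones≡0 v count≡0 i

  ones>0 : ∀ {n} (d : Vec Carrier n) m → ones d ≡ suc m → ∃ λ i → lookup d i ≡ 1#
  ones>0 (x ∷ v) m count≡1+m with x ≟ 1#
  ... | yes x≡1 = zero , x≡1
  ... | no _    = let (i , vᵢ≡1) = ones>0 v m count≡1+m in suc i , vᵢ≡1

  ones≡1 : ∀ {n} (d : Vec Carrier n) → ones d ≡ 1 → ∃ λ k → lookup d k ≡ 1# × (∀ i → lookup d i ≡ 1# → i ≡ k)
  ones≡1 (x ∷ v) count≡1 with x ≟ 1#
  ... | yes x≡1 = zero , x≡1 , only-head
    where
    only-head : ∀ i → lookup (x ∷ v) i ≡ 1# → i ≡ zero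
    only-head zero    _    = refl
    only-head (suc i) vᵢ≡1 = ⊥-elim (ones≡0 v (ℕ.suc-injective count≡1) i vᵢ≡1)
  ... | no x≢1 = let (k , vₖ≡1 , unique) = ones≡1 v count≡1 in suc k , vₖ≡1 , only-suc k unique
    where
    only-suc : ∀ k → (∀ i → lookup v i ≡ 1# → i ≡ k) → ∀ i → lookup (x ∷ v) i ≡ 1# → i ≡ suc k
    only-suc k unique zero    x≡1  = ⊥-elim (x≢1 x≡1)
    only-suc k unique (suc i) vᵢ≡1 = cong suc (unique i vᵢ≡1)

  ones≥2 : ∀ {n} (d : Vec Carrier n) m → ones d ≡ suc (suc m) →
           ∃ λ i → ∃ λ j → i ≢ j × lookup d i ≡ 1# × lookup d j ≡ 1#
  ones≥2 (x ∷ v) m count≡2+m with x ≟ 1#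
  ... | yes x≡1 = let (j , vⱼ≡1) = ones>0 v m (ℕ.suc-injective count≡2+m) in zero , suc j , (λ ()) , x≡1 , vⱼ≡1
  ... | no _    = let (i , j , i≢j , vᵢ≡1 , vⱼ≡1) = ones≥2 v m count≡2+m in
                  suc i , suc j , i≢j ∘ Fin.suc-injective , vᵢ≡1 , vⱼ≡1

  -- Two coordinates equal to 1 give two all-ones rows.
  two-ones⇒singular : ∀ {n} (d : Vec Carrier n) {i j} → i ≢ j → lookup d i ≡ 1# → lookup d j ≡ 1# →
                      ¬ Invertible F (schrodingerK F d)
  two-ones⇒singular d {i} {j} i≢j dᵢ≡1 dⱼ≡1 =
    equal-rows⇒singular 0≢1 (schrodingerK F d) i≢j (λ k → trans (all-ones i dᵢ≡1 k) (sym (all-ones j dⱼ≡1 k)))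
    where
    all-ones : ∀ i → lookup d i ≡ 1# → ∀ k → schrodingerK F d i k ≡ 1#
    all-ones i dᵢ≡1 k = begin
      schrodingerK F d i k            ≡⟨ M-entry d i k ⟩
      1# + δ i k * (lookup d i - 1#)  ≡⟨ cong (λ x → 1# + δ i k * (x - 1#)) dᵢ≡1 ⟩
      1# + δ i k * (1# - 1#)          ≡⟨ ≈⇒≡ (solve 1 (λ δ → :1 :+ δ :* (:1 :- :1) := :1) ≈-refl (δ i k)) ⟩
      1#                              ∎

  Criterion : ∀ {n} → Vec Carrier n → Set
  Criterion d = ones d ≡ 1 ⊎ (ones d ≡ 0 × 1# + σ d ≢ 0#)

  invertible⇒criterion : ∀ {n} (d : Vec Carrier n) → Invertible F (schrodingerK F d) → Criterion d
  invertible⇒criterion d invertible with ones d in count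
  ... | 0 with (1# + σ d) ≟ 0#
  ...   | yes 1+σ≡0 = ⊥-elim (balanced⇒singular d (ones≡0 d count) 1+σ≡0 invertible)
  ...   | no 1+σ≢0  = inj₂ (refl , 1+σ≢0)
  invertible⇒criterion d invertible | 1 = inj₁ refl
  invertible⇒criterion d invertible | suc (suc m) =
    let (i , j , i≢j , dᵢ≡1 , dⱼ≡1) = ones≥2 d m count in ⊥-elim (two-ones⇒singular d i≢j dᵢ≡1 dⱼ≡1 invertible)

  criterion⇒invertible : ∀ {n} (d : Vec Carrier n) → Criterion d → Invertible F (schrodingerK F d)
  criterion⇒invertible d (inj₁ count≡1) =
    let (k , dₖ≡1 , unique) = ones≡1 d count≡1 in unique-one⇒invertible d k dₖ≡1 unique
  criterion⇒invertible d (inj₂ (count≡0 , 1+σ≢0)) = unbalanced⇒invertible d (ones≡0 d count≡0) 1+σ≢0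

module InvertibleCount
  (F : CommutativeRing 0ℓ 0ℓ) (isField : IsField F)
  (≈⇒≡ : ∀ {x y} → CommutativeRing._≈_ F x y → x ≡ y)
  {q : ℕ} (enumeration : CommutativeRing.Carrier F ↔ Fin q)
  (r : ℕ) (q≡2+r : q ≡ ℕ.suc (ℕ.suc r)) where

  open import Data.Nat using (zero; suc; _+_; _*_; _^_)
  import Data.Nat.Properties as ℕ
  open import Data.Nat.Tactic.RingSolver using (solve-∀)
  open import Data.Vec using (Vec; _∷_)
  open import Data.Product using (_×_; _,_)
  open import Function using (_∘_)
  open import Relation.Nullary using (Dec; yes; no)
  open import Relation.Nullary.Decidable using (¬?; _×-dec_; _⊎-dec_)
  open ≡ using (refl; sym; trans; cong; cong₂; _≢_)
  open ≡.≡-Reasoning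

  module R = CommutativeRing F
  open R using (Carrier; 0#; 1#)
  open Counting
  open Enumerated enumeration
  open FieldArithmetic F isField ≈⇒≡ _≟_
  open SchrodingerInvertibility F isField ≈⇒≡ _≟_
  open IntegerSolver F using (solve; _:=_; _:+_; _:-_; :1)
  import Data.Integer as ℤ
  open ℤ using (+_)
  import Data.Integer.Properties as ℤ
  import Data.Integer.DivMod as ℤ
  import Data.Nat.DivMod as ℕ
  open import Data.Integer.Tactic.RingSolver using () renaming (solve-∀ to ℤ-solve-∀)

  𝟙≢1 : Carrier → ℕ
  𝟙≢1 x = 𝟙 (¬? (x ≟ 1#))

  ∑ᶜ-𝟙≢1 : ∑ᶜ 𝟙≢1 ≡ suc r
  ∑ᶜ-𝟙≢1 = ℕ.suc-injective (trans (∑ᶜ-≢ 1#) q≡2+r)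

  𝟙-ones≡0-∷ : ∀ {n} x (v : Vec Carrier n) → 𝟙 (ones (x ∷ v) ℕ.≟ 0) ≡ 𝟙≢1 x * 𝟙 (ones v ℕ.≟ 0)
  𝟙-ones≡0-∷ x v = by-cases (x ≟ 1#)
    where
    by-cases : (x≟1 : Dec (x ≡ 1#)) → 𝟙 (𝟙 x≟1 + ones v ℕ.≟ 0) ≡ 𝟙 (¬? x≟1) * 𝟙 (ones v ℕ.≟ 0)
    by-cases (yes _) = refl
    by-cases (no _)  = sym (ℕ.+-identityʳ _)

  𝟙-ones≡1-∷ : ∀ {n} x (v : Vec Carrier n) →
               𝟙 (ones (x ∷ v) ℕ.≟ 1) ≡ 𝟙 (x ≟ 1#) * 𝟙 (ones v ℕ.≟ 0) + 𝟙≢1 x * 𝟙 (ones v ℕ.≟ 1)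
  𝟙-ones≡1-∷ x v = by-cases (x ≟ 1#)
    where
    by-cases : (x≟1 : Dec (x ≡ 1#)) →
               𝟙 (𝟙 x≟1 + ones v ℕ.≟ 1) ≡ 𝟙 x≟1 * 𝟙 (ones v ℕ.≟ 0) + 𝟙 (¬? x≟1) * 𝟙 (ones v ℕ.≟ 1)
    by-cases (yes _) = trans (𝟙-⇔ (suc (ones v) ℕ.≟ 1) (ones v ℕ.≟ 0) ℕ.suc-injective (cong suc))
                             (sym (trans (ℕ.+-identityʳ _) (ℕ.+-identityʳ _)))
    by-cases (no _)  = sym (ℕ.+-identityʳ _)

  𝟙-σ-∷ : ∀ {n} x (v : Vec Carrier n) c → 𝟙 (σ (x ∷ v) ≟ c) ≡ 𝟙 (σ v ≟ (c R.- (x R.- 1#) ⁻¹))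
  𝟙-σ-∷ x v c = 𝟙-⇔ (σ (x ∷ v) ≟ c) (σ v ≟ (c R.- a)) (λ e → trans (≈⇒≡ (cancel a (σ v))) (cong (R._- a) e))
                                                         (λ e → trans (cong (a R.+_) e) (≈⇒≡ (restore a c)))
    where
    a = (x R.- 1#) ⁻¹
    cancel : ∀ a s → s R.≈ (a R.+ s) R.- a
    cancel = solve 2 (λ a s → s := (a :+ s) :- a) R.refl
    restore : ∀ a c → a R.+ (c R.- a) R.≈ c
    restore = solve 2 (λ a c → a :+ (c :- a) := c) R.refl

  Z₀ Z₁ : ℕ → ℕ
  Z₀ n = count n (λ v → 𝟙 (ones v ℕ.≟ 0))
  Z₁ n = count n (λ v → 𝟙 (ones v ℕ.≟ 1))

  T : ℕ → Carrier → ℕ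
  T n c = count n (λ v → 𝟙 (ones v ℕ.≟ 0) * 𝟙 (σ v ≟ c))

  -- Z₀ n = (q − 1)ⁿ: every coordinate ranges over the 1 + r elements ≠ 1.
  Z₀-closed : ∀ n → Z₀ n ≡ suc r ^ n
  Z₀-closed zero    = refl
  Z₀-closed (suc n) = begin
    Z₀ (suc n)                ≡⟨ count-∷ n (λ v → 𝟙 (ones v ℕ.≟ 0)) 𝟙≢1 (λ _ v → 𝟙 (ones v ℕ.≟ 0)) 𝟙-ones≡0-∷ ⟩
    ∑ᶜ (λ x → 𝟙≢1 x * Z₀ n)   ≡⟨ ∑ᶜ-*ʳ 𝟙≢1 (Z₀ n) ⟩
    ∑ᶜ 𝟙≢1 * Z₀ n             ≡⟨ cong₂ _*_ ∑ᶜ-𝟙≢1 (Z₀-closed n) ⟩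
    suc r * suc r ^ n         ∎

  Z₁-suc : ∀ m → Z₁ (suc m) ≡ Z₀ m + suc r * Z₁ m
  Z₁-suc m = begin
    Z₁ (suc m)
      ≡⟨ count-cong (suc m) {λ v → 𝟙 (ones v ℕ.≟ 1)} {λ v → first v + second v} (λ { (x ∷ v) → 𝟙-ones≡1-∷ x v }) ⟩
    count (suc m) (λ v → first v + second v)             ≡⟨ count-+ (suc m) first second ⟩
    count (suc m) first + count (suc m) second
      ≡⟨ cong₂ _+_ (count-∷ m first (λ x → 𝟙 (x ≟ 1#)) (λ _ v → 𝟙 (ones v ℕ.≟ 0)) (λ _ _ → refl))
                   (count-∷ m second 𝟙≢1 (λ _ v → 𝟙 (ones v ℕ.≟ 1)) (λ _ _ → refl)) ⟩
    ∑ᶜ (λ x → 𝟙 (x ≟ 1#) * Z₀ m) + ∑ᶜ (λ x → 𝟙≢1 x * Z₁ m)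
      ≡⟨ cong₂ _+_ (∑ᶜ-*ʳ (λ x → 𝟙 (x ≟ 1#)) (Z₀ m)) (∑ᶜ-*ʳ 𝟙≢1 (Z₁ m)) ⟩
    ∑ᶜ (λ x → 𝟙 (x ≟ 1#)) * Z₀ m + ∑ᶜ 𝟙≢1 * Z₁ m        ≡⟨ cong₂ (λ a b → a * Z₀ m + b * Z₁ m) (∑ᶜ-δ 1#) ∑ᶜ-𝟙≢1 ⟩
    1 * Z₀ m + suc r * Z₁ m                              ≡⟨ cong (_+ suc r * Z₁ m) (ℕ.*-identityˡ (Z₀ m)) ⟩
    Z₀ m + suc r * Z₁ m                                  ∎
    where
    first second : Vec Carrier (suc m) → ℕ
    first  (x ∷ v) = 𝟙 (x ≟ 1#) * 𝟙 (ones v ℕ.≟ 0)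
    second (x ∷ v) = 𝟙≢1 x * 𝟙 (ones v ℕ.≟ 1)

  Z₁-closed : ∀ m → Z₁ (suc m) ≡ suc m * suc r ^ m
  Z₁-closed zero    = trans (Z₁-suc 0) (cong suc (ℕ.*-zeroʳ r))
  Z₁-closed (suc m) = begin
    Z₁ (suc (suc m))
      ≡⟨ Z₁-suc (suc m) ⟩
    Z₀ (suc m) + suc r * Z₁ (suc m)
      ≡⟨ cong₂ (λ a b → a + suc r * b) (Z₀-closed (suc m)) (Z₁-closed m) ⟩
    suc r ^ suc m + suc r * (suc m * suc r ^ m)
      ≡⟨ regroup m r (suc r ^ m) ⟩
    suc (suc m) * suc r ^ suc m ∎
    where
    regroup : ∀ m r p → suc r * p + suc r * (suc m * p) ≡ suc (suc m) * (suc r * p)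
    regroup = solve-∀

  -- After prepending x, the tail must have σ = c − (x − 1)⁻¹.
  remaining : Carrier → Carrier → Carrier
  remaining c x = c R.- (x R.- 1#) ⁻¹

  T-suc : ∀ n c → T (suc n) c ≡ ∑ᶜ (λ x → 𝟙≢1 x * T n (remaining c x))
  T-suc n c = count-∷ n (λ v → 𝟙 (ones v ℕ.≟ 0) * 𝟙 (σ v ≟ c)) 𝟙≢1
                        (λ x v → 𝟙 (ones v ℕ.≟ 0) * 𝟙 (σ v ≟ remaining c x))
                        (λ x v → trans (cong₂ _*_ (𝟙-ones≡0-∷ x v) (𝟙-σ-∷ x v c)) (ℕ.*-assoc (𝟙≢1 x) _ _))

  reciprocal-hit : ∀ c x → (x ≢ 1# × remaining c x ≡ 0#) → (x ≡ 1# R.+ c ⁻¹ × c ≢ 0#)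
  reciprocal-hit c x (x≢1 , c-a≡0) = x≡1+c⁻¹ , c≢0
    where
    x-1≢0 : x R.- 1# ≢ 0#
    x-1≢0 = x≢1 ∘ difference-zero x 1#
    c≡a : c ≡ (x R.- 1#) ⁻¹
    c≡a = difference-zero c _ c-a≡0
    c≢0 : c ≢ 0#
    c≢0 c≡0 = ⁻¹-nonzero (x R.- 1#) x-1≢0 (trans (sym c≡a) c≡0)
    x≡1+c⁻¹ : x ≡ 1# R.+ c ⁻¹
    x≡1+c⁻¹ = begin
      x                          ≡⟨ ≈⇒≡ (solve 1 (λ x → x := :1 :+ (x :- :1)) R.refl x) ⟩
      1# R.+ (x R.- 1#)          ≡⟨ cong (1# R.+_) (⁻¹-involutive (x R.- 1#) x-1≢0) ⟨
      1# R.+ (x R.- 1#) ⁻¹ ⁻¹    ≡⟨ cong (λ a → 1# R.+ a ⁻¹) c≡a ⟨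
      1# R.+ c ⁻¹                ∎

  reciprocal-hit⁻¹ : ∀ c x → (x ≡ 1# R.+ c ⁻¹ × c ≢ 0#) → (x ≢ 1# × remaining c x ≡ 0#)
  reciprocal-hit⁻¹ c x (x≡1+c⁻¹ , c≢0) = x≢1 , c-a≡0
    where
    x-1≡c⁻¹ : x R.- 1# ≡ c ⁻¹
    x-1≡c⁻¹ = trans (cong (R._- 1#) x≡1+c⁻¹) (≈⇒≡ (solve 1 (λ a → (:1 :+ a) :- :1 := a) R.refl (c ⁻¹)))
    x≢1 : x ≢ 1#
    x≢1 x≡1 = ⁻¹-nonzero c c≢0 (trans (sym x-1≡c⁻¹) (trans (cong (R._- 1#) x≡1) (≈⇒≡ (R.-‿inverseʳ 1#))))
    c-a≡0 : remaining c x ≡ 0#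
    c-a≡0 = begin
      c R.- (x R.- 1#) ⁻¹   ≡⟨ cong (λ a → c R.- a ⁻¹) x-1≡c⁻¹ ⟩
      c R.- c ⁻¹ ⁻¹         ≡⟨ cong (λ a → c R.- a) (⁻¹-involutive c c≢0) ⟩
      c R.- c               ≡⟨ ≈⇒≡ (R.-‿inverseʳ c) ⟩
      0#                    ∎

  hit miss : Carrier → ℕ
  hit c  = ∑ᶜ (λ x → 𝟙≢1 x * 𝟙 (remaining c x ≟ 0#))
  miss c = ∑ᶜ (λ x → 𝟙≢1 x * 𝟙 (¬? (remaining c x ≟ 0#)))

  hit≡ : ∀ c → hit c ≡ 𝟙 (¬? (c ≟ 0#))
  hit≡ c = begin
    ∑ᶜ (λ x → 𝟙≢1 x * 𝟙 (remaining c x ≟ 0#))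
      ≡⟨ ∑ᶜ-cong (λ x → sym (𝟙-× (¬? (x ≟ 1#)) (remaining c x ≟ 0#))) ⟩
    ∑ᶜ (λ x → 𝟙 (¬? (x ≟ 1#) ×-dec (remaining c x ≟ 0#)))
      ≡⟨ ∑ᶜ-cong (λ x → 𝟙-⇔ (¬? (x ≟ 1#) ×-dec (remaining c x ≟ 0#)) ((x ≟ 1# R.+ c ⁻¹) ×-dec ¬? (c ≟ 0#))
                              (reciprocal-hit c x) (reciprocal-hit⁻¹ c x)) ⟩
    ∑ᶜ (λ x → 𝟙 ((x ≟ 1# R.+ c ⁻¹) ×-dec ¬? (c ≟ 0#)))
      ≡⟨ ∑ᶜ-cong (λ x → 𝟙-× (x ≟ 1# R.+ c ⁻¹) (¬? (c ≟ 0#))) ⟩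
    ∑ᶜ (λ x → 𝟙 (x ≟ 1# R.+ c ⁻¹) * 𝟙 (¬? (c ≟ 0#)))
      ≡⟨ ∑ᶜ-*ʳ (λ x → 𝟙 (x ≟ 1# R.+ c ⁻¹)) _ ⟩
    ∑ᶜ (λ x → 𝟙 (x ≟ 1# R.+ c ⁻¹)) * 𝟙 (¬? (c ≟ 0#))
      ≡⟨ cong (_* 𝟙 (¬? (c ≟ 0#))) (∑ᶜ-δ (1# R.+ c ⁻¹)) ⟩
    1 * 𝟙 (¬? (c ≟ 0#))
      ≡⟨ ℕ.*-identityˡ _ ⟩
    𝟙 (¬? (c ≟ 0#)) ∎

  hit+miss : ∀ c → hit c + miss c ≡ suc r
  hit+miss c = begin
    ∑ᶜ (λ x → 𝟙≢1 x * 𝟙 (y x ≟ 0#)) + ∑ᶜ (λ x → 𝟙≢1 x * 𝟙 (¬? (y x ≟ 0#)))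
      ≡⟨ ∑ᶜ-+ (λ x → 𝟙≢1 x * 𝟙 (y x ≟ 0#)) (λ x → 𝟙≢1 x * 𝟙 (¬? (y x ≟ 0#))) ⟨
    ∑ᶜ (λ x → 𝟙≢1 x * 𝟙 (y x ≟ 0#) + 𝟙≢1 x * 𝟙 (¬? (y x ≟ 0#)))
      ≡⟨ ∑ᶜ-cong (λ x → sym (ℕ.*-distribˡ-+ (𝟙≢1 x) (𝟙 (y x ≟ 0#)) (𝟙 (¬? (y x ≟ 0#))))) ⟩
    ∑ᶜ (λ x → 𝟙≢1 x * (𝟙 (y x ≟ 0#) + 𝟙 (¬? (y x ≟ 0#))))
      ≡⟨ ∑ᶜ-cong (λ x → trans (cong (𝟙≢1 x *_) (𝟙-complement (y x ≟ 0#))) (ℕ.*-identityʳ (𝟙≢1 x))) ⟩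
    ∑ᶜ 𝟙≢1
      ≡⟨ ∑ᶜ-𝟙≢1 ⟩
    suc r ∎
    where y = remaining c

  -- T n c only depends on whether c = 0: it is α n if c = 0 and β n otherwise,
  -- where α and β satisfy the recurrence below.
  α β : ℕ → ℕ
  α zero    = 1
  α (suc n) = suc r * β n
  β zero    = 0
  β (suc n) = α n + r * β n

  τ : ℕ → Carrier → ℕ
  τ n c = 𝟙 (c ≟ 0#) * α n + 𝟙 (¬? (c ≟ 0#)) * β n

  ∑-τ : ∀ n c → ∑ᶜ (λ x → 𝟙≢1 x * τ n (remaining c x)) ≡ hit c * α n + miss c * β n
  ∑-τ n c = begin
    ∑ᶜ (λ x → 𝟙≢1 x * (𝟙 (y x ≟ 0#) * α n + 𝟙 (¬? (y x ≟ 0#)) * β n))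
      ≡⟨ ∑ᶜ-cong (λ x → distribute (𝟙≢1 x) (𝟙 (y x ≟ 0#)) (𝟙 (¬? (y x ≟ 0#))) (α n) (β n)) ⟩
    ∑ᶜ (λ x → 𝟙≢1 x * 𝟙 (y x ≟ 0#) * α n + 𝟙≢1 x * 𝟙 (¬? (y x ≟ 0#)) * β n)
      ≡⟨ ∑ᶜ-+ (λ x → 𝟙≢1 x * 𝟙 (y x ≟ 0#) * α n) (λ x → 𝟙≢1 x * 𝟙 (¬? (y x ≟ 0#)) * β n) ⟩
    ∑ᶜ (λ x → 𝟙≢1 x * 𝟙 (y x ≟ 0#) * α n) + ∑ᶜ (λ x → 𝟙≢1 x * 𝟙 (¬? (y x ≟ 0#)) * β n)
      ≡⟨ cong₂ _+_ (∑ᶜ-*ʳ (λ x → 𝟙≢1 x * 𝟙 (y x ≟ 0#)) (α n)) (∑ᶜ-*ʳ (λ x → 𝟙≢1 x * 𝟙 (¬? (y x ≟ 0#))) (β n)) ⟩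
    hit c * α n + miss c * β n ∎
    where
    y = remaining c
    distribute : ∀ k a b s t → k * (a * s + b * t) ≡ k * a * s + k * b * t
    distribute = solve-∀

  -- The recurrence of α and β: for c = 0 there are no hits and 1 + r misses,
  -- for c ≠ 0 one hit and r misses.
  τ-suc : ∀ n c → hit c * α n + miss c * β n ≡ τ (suc n) c
  τ-suc n c = by-cases (hit c) (miss c) (c ≟ 0#) (hit≡ c) (hit+miss c)
    where
    by-cases : ∀ h m (c≟0 : Dec (c ≡ 0#)) → h ≡ 𝟙 (¬? c≟0) → h + m ≡ suc r →
               h * α n + m * β n ≡ 𝟙 c≟0 * α (suc n) + 𝟙 (¬? c≟0) * β (suc n)
    by-cases .0 .(suc r) (yes _) refl refl = arrange (α n) (β n) r
      where
      arrange : ∀ a b r → 0 * a + suc r * b ≡ 1 * (suc r * b) + 0 * (a + r * b)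
      arrange = solve-∀
    by-cases .1 .r (no _) refl refl = arrange (α n) (β n) r
      where
      arrange : ∀ a b r → 1 * a + r * b ≡ 0 * (suc r * b) + 1 * (a + r * b)
      arrange = solve-∀

  T-closed : ∀ n c → T n c ≡ τ n c
  T-closed zero c = base (c ≟ 0#)
    where
    -- the empty tuple has σ = 0
    base : (c≟0 : Dec (c ≡ 0#)) → 1 * 𝟙 (0# ≟ c) ≡ 𝟙 c≟0 * 1 + 𝟙 (¬? c≟0) * 0
    base (yes c≡0) = trans (cong (λ x → 1 * 𝟙 (0# ≟ x)) c≡0) (cong (_+ 0) (𝟙-yes (0# ≟ 0#) refl))
    base (no c≢0)  = cong (_+ 0) (𝟙-no (0# ≟ c) (c≢0 ∘ sym))
  T-closed (suc n) c = begin
    T (suc n) c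
      ≡⟨ T-suc n c ⟩
    ∑ᶜ (λ x → 𝟙≢1 x * T n (remaining c x))
      ≡⟨ ∑ᶜ-cong (λ x → cong (𝟙≢1 x *_) (T-closed n (remaining c x))) ⟩
    ∑ᶜ (λ x → 𝟙≢1 x * τ n (remaining c x))
      ≡⟨ ∑-τ n c ⟩
    hit c * α n + miss c * β n
      ≡⟨ τ-suc n c ⟩
    τ (suc n) c ∎

  criterion? : ∀ {n} (d : Vec Carrier n) → Dec (Criterion d)
  criterion? d = (ones d ℕ.≟ 1) ⊎-dec ((ones d ℕ.≟ 0) ×-dec ¬? ((1# R.+ σ d) ≟ 0#))

  X : ℕ → ℕ
  X n = count n (λ v → 𝟙 (ones v ℕ.≟ 0) * 𝟙 (¬? ((1# R.+ σ v) ≟ 0#)))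

  count-criterion : ∀ n → count n (λ v → 𝟙 (criterion? v)) ≡ Z₁ n + X n
  count-criterion n = trans (count-cong n split) (count-+ n (λ v → 𝟙 (ones v ℕ.≟ 1)) _)
    where
    split : ∀ v → 𝟙 (criterion? v) ≡ 𝟙 (ones v ℕ.≟ 1) + 𝟙 (ones v ℕ.≟ 0) * 𝟙 (¬? ((1# R.+ σ v) ≟ 0#))
    split v = trans (𝟙-⊎ (ones v ℕ.≟ 1) _ (λ one (none , _) → ℕ.1+n≢0 (trans (sym one) none)))
                    (cong (λ t → 𝟙 (ones v ℕ.≟ 1) + t) (𝟙-× (ones v ℕ.≟ 0) _))

  -- 1 + σ = 0 iff σ = −1, so X n and T n (−1) split Z₀ n.
  X+T≡Z₀ : ∀ n → X n + T n (R.- 1#) ≡ Z₀ n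
  X+T≡Z₀ n = trans (sym (count-+ n _ _)) (count-cong n split)
    where
    σ≡-1⇔ : ∀ {n} (v : Vec Carrier n) → 𝟙 (σ v ≟ R.- 1#) ≡ 𝟙 ((1# R.+ σ v) ≟ 0#)
    σ≡-1⇔ v = 𝟙-⇔ (σ v ≟ R.- 1#) ((1# R.+ σ v) ≟ 0#)
      (λ σ≡-1 → trans (cong (1# R.+_) σ≡-1) (≈⇒≡ (R.-‿inverseʳ 1#)))
      (λ 1+σ≡0 → trans (≈⇒≡ (solve 1 (λ s → s := (:1 :+ s) :- :1) R.refl (σ v)))
                       (trans (cong (R._- 1#) 1+σ≡0) (≈⇒≡ (R.+-identityˡ (R.- 1#)))))
    split : ∀ v → 𝟙 (ones v ℕ.≟ 0) * 𝟙 (¬? ((1# R.+ σ v) ≟ 0#)) + 𝟙 (ones v ℕ.≟ 0) * 𝟙 (σ v ≟ R.- 1#)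
                  ≡ 𝟙 (ones v ℕ.≟ 0)
    split v = begin
      z * 𝟙 (¬? p?) + z * 𝟙 (σ v ≟ R.- 1#)
        ≡⟨ cong (λ t → z * 𝟙 (¬? p?) + z * t) (σ≡-1⇔ v) ⟩
      z * 𝟙 (¬? p?) + z * 𝟙 p?
        ≡⟨ ℕ.*-distribˡ-+ z (𝟙 (¬? p?)) (𝟙 p?) ⟨
      z * (𝟙 (¬? p?) + 𝟙 p?)
        ≡⟨ cong (z *_) (trans (ℕ.+-comm (𝟙 (¬? p?)) (𝟙 p?)) (𝟙-complement p?)) ⟩
      z * 1
        ≡⟨ ℕ.*-identityʳ z ⟩
      z ∎
      where z = 𝟙 (ones v ℕ.≟ 0); p? = (1# R.+ σ v) ≟ 0#

  -- As −1 ≠ 0, T n (−1) = β n.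
  T-1≡β : ∀ n → T n (R.- 1#) ≡ β n
  T-1≡β n = begin
    T n (R.- 1#)
      ≡⟨ T-closed n (R.- 1#) ⟩
    𝟙 -1≟0 * α n + 𝟙 (¬? -1≟0) * β n
      ≡⟨ cong₂ (λ a b → a * α n + b * β n) (𝟙-no -1≟0 -1≢0) (𝟙-yes (¬? -1≟0) -1≢0) ⟩
    0 * α n + 1 * β n
      ≡⟨ ℕ.+-identityʳ (β n) ⟩
    β n ∎
    where -1≟0 = R.- 1# ≟ 0#

  sign : ℕ → ℤ.ℤ
  sign n = (ℤ.- + 1) ℤ.^ n

  +-^ : ∀ k n → + (k ^ n) ≡ (+ k) ℤ.^ n
  +-^ k zero    = refl
  +-^ k (suc n) = trans (ℤ.pos-* k (k ^ n)) (cong (+ k ℤ.*_) (+-^ k n))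

  +-linear : ∀ a b c → + (a + b * c) ≡ + a ℤ.+ + b ℤ.* + c
  +-linear a b c = trans (ℤ.pos-+ a (b * c)) (cong (ℤ._+_ (+ a)) (ℤ.pos-* b c))

  α≡β+sign : ∀ n → + α n ≡ + β n ℤ.+ sign n
  α≡β+sign zero    = refl
  α≡β+sign (suc n) = begin
    + (suc r * β n)
      ≡⟨ ℤ.pos-* (suc r) (β n) ⟩
    (ℤ.1ℤ ℤ.+ + r) ℤ.* + β n
      ≡⟨ regroup (+ r) (+ β n) (sign n) ⟩
    ((+ β n ℤ.+ sign n) ℤ.+ + r ℤ.* + β n) ℤ.+ sign (suc n)
      ≡⟨ cong (λ a → (a ℤ.+ + r ℤ.* + β n) ℤ.+ sign (suc n)) (α≡β+sign n) ⟨
    (+ α n ℤ.+ + r ℤ.* + β n) ℤ.+ sign (suc n)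
      ≡⟨ cong (ℤ._+ sign (suc n)) (+-linear (α n) r (β n)) ⟨
    + β (suc n) ℤ.+ sign (suc n) ∎
    where
    regroup : ∀ R B S → (ℤ.1ℤ ℤ.+ R) ℤ.* B ≡ ((B ℤ.+ S) ℤ.+ R ℤ.* B) ℤ.+ (ℤ.- + 1) ℤ.* S
    regroup = ℤ-solve-∀

  qβ+sign≡pⁿ : ∀ n → + suc (suc r) ℤ.* + β n ℤ.+ sign n ≡ (+ suc r) ℤ.^ n
  qβ+sign≡pⁿ zero    = cong (ℤ._+ ℤ.1ℤ) (ℤ.*-zeroʳ (+ suc (suc r)))
  qβ+sign≡pⁿ (suc n) = begin
    Q ℤ.* + (α n + r * β n) ℤ.+ sign (suc n)
      ≡⟨ cong (λ a → Q ℤ.* a ℤ.+ sign (suc n)) (+-linear (α n) r (β n)) ⟩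
    Q ℤ.* (+ α n ℤ.+ + r ℤ.* B) ℤ.+ sign (suc n)
      ≡⟨ cong (λ a → Q ℤ.* (a ℤ.+ + r ℤ.* B) ℤ.+ sign (suc n)) (α≡β+sign n) ⟩
    Q ℤ.* ((B ℤ.+ sign n) ℤ.+ + r ℤ.* B) ℤ.+ sign (suc n)
      ≡⟨ regroup (+ r) B (sign n) ⟩
    + suc r ℤ.* (Q ℤ.* B ℤ.+ sign n)
      ≡⟨ cong (+ suc r ℤ.*_) (qβ+sign≡pⁿ n) ⟩
    (+ suc r) ℤ.^ suc n ∎
    where
    Q = + suc (suc r)
    B = + β n
    regroup : ∀ R B S → (ℤ.1ℤ ℤ.+ (ℤ.1ℤ ℤ.+ R)) ℤ.* ((B ℤ.+ S) ℤ.+ R ℤ.* B) ℤ.+ (ℤ.- + 1) ℤ.* S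
                        ≡ (ℤ.1ℤ ℤ.+ R) ℤ.* ((ℤ.1ℤ ℤ.+ (ℤ.1ℤ ℤ.+ R)) ℤ.* B ℤ.+ S)
    regroup = ℤ-solve-∀

  qX≡pⁿ⁺¹+sign : ∀ n → + (X n * suc (suc r)) ≡ (+ suc r) ℤ.^ suc n ℤ.+ sign n
  qX≡pⁿ⁺¹+sign n = begin
    + (X n * suc (suc r))
      ≡⟨ ℤ.pos-* (X n) (suc (suc r)) ⟩
    + X n ℤ.* Q
      ≡⟨ regroup (+ r) (+ X n) B (sign n) ⟩
    Q ℤ.* (+ X n ℤ.+ B) ℤ.- (Q ℤ.* B ℤ.+ sign n) ℤ.+ sign n
      ≡⟨ cong₂ (λ a b → Q ℤ.* a ℤ.- b ℤ.+ sign n) X+β≡pⁿ (qβ+sign≡pⁿ n) ⟩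
    Q ℤ.* pⁿ ℤ.- pⁿ ℤ.+ sign n
      ≡⟨ cong (ℤ._+ sign n) (factor (+ r) pⁿ) ⟩
    (+ suc r) ℤ.^ suc n ℤ.+ sign n ∎
    where
    Q = + suc (suc r)
    B = + β n
    pⁿ = (+ suc r) ℤ.^ n
    X+β≡pⁿ : + X n ℤ.+ B ≡ pⁿ
    X+β≡pⁿ = begin
      + X n ℤ.+ B             ≡⟨ ℤ.pos-+ (X n) (β n) ⟨
      + (X n + β n)           ≡⟨ cong (λ t → + (X n + t)) (T-1≡β n) ⟨
      + (X n + T n (R.- 1#))  ≡⟨ cong ℤ.+_ (trans (X+T≡Z₀ n) (Z₀-closed n)) ⟩
      + (suc r ^ n)           ≡⟨ +-^ (suc r) n ⟩
      pⁿ                        ∎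
    regroup : ∀ R X B S → X ℤ.* (ℤ.1ℤ ℤ.+ (ℤ.1ℤ ℤ.+ R))
                          ≡ (ℤ.1ℤ ℤ.+ (ℤ.1ℤ ℤ.+ R)) ℤ.* (X ℤ.+ B) ℤ.- ((ℤ.1ℤ ℤ.+ (ℤ.1ℤ ℤ.+ R)) ℤ.* B ℤ.+ S) ℤ.+ S
    regroup = ℤ-solve-∀
    factor : ∀ R V → (ℤ.1ℤ ℤ.+ (ℤ.1ℤ ℤ.+ R)) ℤ.* V ℤ.- V ≡ (ℤ.1ℤ ℤ.+ R) ℤ.* V
    factor = ℤ-solve-∀

  count-formula : ∀ m N → HasCount (λ (d : Vec Carrier (suc m)) → Invertible F (schrodingerK F d)) N →
                  + N ≡ ((+ suc r) ℤ.^ suc (suc m) ℤ.+ sign (suc m)) ℤ./ + suc (suc r) ℤ.+ + suc m ℤ.* (+ suc r) ℤ.^ m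
  count-formula m N has-count = begin
    + N                    ≡⟨ cong +_ N≡Z₁+X ⟩
    + (Z₁ n + X n)         ≡⟨ ℤ.pos-+ (Z₁ n) (X n) ⟩
    + Z₁ n ℤ.+ + X n       ≡⟨ ℤ.+-comm (+ Z₁ n) (+ X n) ⟩
    + X n ℤ.+ + Z₁ n       ≡⟨ cong₂ ℤ._+_ X≡quotient Z₁≡ ⟩
    ((+ suc r) ℤ.^ suc n ℤ.+ sign n) ℤ./ + suc (suc r) ℤ.+ + n ℤ.* (+ suc r) ℤ.^ m ∎
    where
    n = suc m
    N≡Z₁+X : N ≡ Z₁ n + X n
    N≡Z₁+X = trans (HasCount-unique has-count
                      (HasCount-⇔ criterion⇒invertible invertible⇒criterion (HasCount-count n Criterion criterion?)))
                   (count-criterion n)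
    X≡quotient : + X n ≡ ((+ suc r) ℤ.^ suc n ℤ.+ sign n) ℤ./ + suc (suc r)
    X≡quotient = begin
      + X n                                            ≡⟨ cong +_ (ℕ.m*n/n≡m (X n) (suc (suc r))) ⟨
      + (X n * suc (suc r) ℕ./ suc (suc r))            ≡⟨ ℤ.div-pos-is-/ℕ (+ (X n * suc (suc r))) (suc (suc r)) ⟨
      + (X n * suc (suc r)) ℤ./ + suc (suc r)          ≡⟨ cong (ℤ._/ + suc (suc r)) (qX≡pⁿ⁺¹+sign n) ⟩
      ((+ suc r) ℤ.^ suc n ℤ.+ sign n) ℤ./ + suc (suc r) ∎
    Z₁≡ : + Z₁ n ≡ + n ℤ.* (+ suc r) ℤ.^ m
    Z₁≡ = trans (cong +_ (Z₁-closed m)) (trans (ℤ.pos-* n (suc r ^ m)) (cong (+ n ℤ.*_) (+-^ (suc r) m)))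

open import Data.Product using (∃; _,_; proj₁)
open import Data.Empty using (⊥; ⊥-elim)
open import Data.Nat using (_≤_; _∸_; suc; s≤s; z≤n)
import Data.Fin.Properties as Fin
open import Function.Bundles using (Inverse)

-- A field has the two distinct elements 0 and 1, so q = 2 + r.
at-least-two : ∀ (F : CommutativeRing 0ℓ 0ℓ) → IsField F → ∀ {q} → (CommutativeRing.Carrier F ↔ Fin q) →
               ∃ λ r → q ≡ suc (suc r)
at-least-two F isField {q} enumeration = two≤q⇒ (Fin.injective⇒≤ embed-injective)
  where
  open CommutativeRing F using (0#; 1#; reflexive)
  open Inverse enumeration using (to; from; strictlyInverseʳ)
  to-injective : ∀ {x y} → to x ≡ to y → x ≡ y
  to-injective {x} {y} eq = ≡.trans (≡.sym (strictlyInverseʳ x)) (≡.trans (≡.cong from eq) (strictlyInverseʳ y))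
  0≢1 : to 0# ≡ to 1# → ⊥
  0≢1 eq = proj₁ isField (reflexive (to-injective eq))
  embed : Fin 2 → Fin q
  embed Fin.zero           = to 0#
  embed (Fin.suc Fin.zero) = to 1#
  embed-injective : ∀ {i j} → embed i ≡ embed j → i ≡ j
  embed-injective {Fin.zero}           {Fin.zero}           _  = ≡.refl
  embed-injective {Fin.zero}           {Fin.suc Fin.zero}   eq = ⊥-elim (0≢1 eq)
  embed-injective {Fin.suc Fin.zero}   {Fin.zero}           eq = ⊥-elim (0≢1 (≡.sym eq))
  embed-injective {Fin.suc Fin.zero}   {Fin.suc Fin.zero}   _  = ≡.refl
  two≤q⇒ : ∀ {q} → 2 ≤ q → ∃ λ r → q ≡ suc (suc r)
  two≤q⇒ (s≤s (s≤s _)) = _ , ≡.refl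

open import Data.Vec using (Vec)
open import Data.Integer using (+_; -_; _+_; _-_; _*_; _^_; NonZero)
open import Data.Integer.DivMod using (_/_)

theorem3 : (F : CommutativeRing 0ℓ 0ℓ) → IsField F →
    (∀ {x y} → CommutativeRing._≈_ F x y → x ≡ y) →
    (q : ℕ) → (CommutativeRing.Carrier F ↔ Fin q) → .{{_ : NonZero (+ q)}} →
    (n : ℕ) → 1 ≤ n → (N : ℕ) →
    HasCount (λ (d : Vec (CommutativeRing.Carrier F) n) → Invertible F (schrodingerK F d)) N →
    + N ≡ ((+ q - + 1) ^ (ℕ.suc n) + (- + 1) ^ n) / (+ q) + (+ n) * (+ q - + 1) ^ (n ∸ 1)
theorem3 F isField ≈⇒≡ q enumeration (suc m) (s≤s z≤n) N invertible-count with at-least-two F isField enumeration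
... | r , ≡.refl = InvertibleCount.count-formula F isField ≈⇒≡ enumeration r ≡.refl m N invertible-count
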